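{- Let $n\ge 4$, let $AQ_n=\mathrm{Cay}(\mathbb{Z}_2^n,S)$ be the augmented cube graph, $G=\mathrm{Aut}(AQ_n)$, and $G_e$ the stabilizer in $G$ of the zero vector $e$. Then $G_e\cong D_8$, $AQ_n$ is a normal Cayley graph, and $\mathrm{Aut}(AQ_n)\cong \mathbb{Z}_2^n\rtimes D_8$.
   Context: For a group $H$ and a subset $S\subseteq H$ not containing the identity and closed under inverses, $\mathrm{Cay}(H,S)$ is the undirected graph with vertex set $H$ in which $h$ and $sh$ are adjacent for all $h\in H$, $s\in S$. Identify $\mathbb{Z}_2^n$ with $\mathbb{F}_2^n$; $e_i$ is the $i$-th unit vector. The augmented cube graph $AQ_n$ is $\mathrm{Cay}(\mathbb{Z}_2^n,S)$ with $S=\{e_1,\dots,e_n\}\cup\{e_{n-k+1}+\cdots+e_n : 2\le k\le n\}$ (so $|S|=2n-1$). $R(H)$ is the right regular representation of $H$ (for $\mathbb{Z}_2^n$, the translations $x\mapsto x+z$), $\mathrm{Aut}(H,S)$ the group of group automorphisms of $H$ mapping $S$ onto itself, and $\mathrm{Cay}(H,S)$ is normal if its full automorphism group equals $R(H)\,\mathrm{Aut}(H,S)$. $D_8$ is the dihedral group of order 8. -}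

module Defs where

open import Data.Bool using (Bool; true; false; _xor_; if_then_else_)
open import Data.Nat using (ℕ; _+_; _∸_; _≤_; _≤ᵇ_)
open import Data.Nat.DivMod using (_mod_)
open import Data.Fin using (Fin; toℕ)
open import Data.Fin.Properties using () renaming (_≟_ to _≟ᶠ_)
open import Data.Vec using (Vec; replicate; zipWith; tabulate)
open import Data.Product using (Σ; ∃; _×_; _,_; proj₁; proj₂)
open import Data.Sum using (_⊎_)
open import Relation.Nullary.Decidable using (⌊_⌋)
open import Relation.Binary.PropositionalEquality using (_≡_; refl; trans; cong)

V : ℕ → Set
V n = Vec Bool n

zeroV : ∀ {n} → V n
zeroV = replicate _ false

infixl 6 _⊕_
_⊕_ : ∀ {n} → V n → V n → V n
_⊕_ = zipWith _xor_

-- unit vector e_{i+1} (indices are 0-based: i : Fin n)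
unitV : ∀ {n} → Fin n → V n
unitV i = tabulate (λ j → ⌊ i ≟ᶠ j ⌋)

-- e_{n-k+1} + ... + e_n : ones in the last k coordinates
-- (0-based positions j with n ∸ k ≤ j)
suffixV : ∀ n → ℕ → V n
suffixV n k = tabulate (λ (j : Fin n) → (n ∸ k) ≤ᵇ toℕ j)

InS : ∀ n → V n → Set
InS n s = (∃ λ (i : Fin n) → s ≡ unitV i)
        ⊎ (∃ λ (k : ℕ) → (2 ≤ k) × (k ≤ n) × (s ≡ suffixV n k))

Adj : ∀ n → V n → V n → Set
Adj n x y = Σ (V n) λ s → InS n s × (y ≡ s ⊕ x)

record GAut (n : ℕ) : Set where
  field
    fun     : V n → V n
    inv     : V n → V n
    fun-inv : ∀ x → fun (inv x) ≡ x
    inv-fun : ∀ x → inv (fun x) ≡ x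
    pres    : ∀ x y → Adj n x y → Adj n (fun x) (fun y)
    refl-   : ∀ x y → Adj n (fun x) (fun y) → Adj n x y
open GAut public

compGAut : ∀ {n} → GAut n → GAut n → GAut n
compGAut σ τ = record
  { fun = λ x → fun σ (fun τ x)
  ; inv = λ x → inv τ (inv σ x)
  ; fun-inv = λ x → trans (cong (fun σ) (fun-inv τ (inv σ x))) (fun-inv σ x)
  ; inv-fun = λ x → trans (cong (inv τ) (inv-fun σ (fun τ x))) (inv-fun τ x)
  ; pres = λ x y a → pres σ _ _ (pres τ x y a)
  ; refl- = λ x y a → refl- τ x y (refl- σ _ _ a)
  }

Stab : ℕ → Set
Stab n = Σ (GAut n) λ σ → fun σ zeroV ≡ zeroV

compStab : ∀ {n} → Stab n → Stab n → Stab n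
compStab (σ , p) (τ , q) =
  compGAut σ τ , trans (cong (fun σ) q) p

record GrpAutS (n : ℕ) : Set where
  field
    afun     : V n → V n
    ainv     : V n → V n
    afun-inv : ∀ x → afun (ainv x) ≡ x
    ainv-fun : ∀ x → ainv (afun x) ≡ x
    hom      : ∀ x y → afun (x ⊕ y) ≡ afun x ⊕ afun y
    S-to     : ∀ s → InS n s → InS n (afun s)
    S-from   : ∀ s → InS n (afun s) → InS n s
open GrpAutS public

-- Normality: Aut(AQ_n) = R(H) Aut(H,S), with R(z) : x ↦ x + z.
IsNormalCayley : ℕ → Set
IsNormalCayley n =
  ((σ : GAut n) → Σ (V n) λ z → Σ (GrpAutS n) λ α → ∀ x → fun σ x ≡ afun α x ⊕ z)
  × ((z : V n) (α : GrpAutS n) → Σ (GAut n) λ σ → ∀ x → fun σ x ≡ afun α x ⊕ z)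

-- Dihedral group D_8 of order 8: elements r^a s^b, a ∈ Z_4, b ∈ Z_2,
-- with s r = r^{-1} s.

D8 : Set
D8 = Fin 4 × Bool

negMod4 : Fin 4 → Fin 4
negMod4 c = (4 ∸ toℕ c) mod 4

_·D8_ : D8 → D8 → D8
(a , b) ·D8 (c , d) =
  ((toℕ a + toℕ (if b then negMod4 c else c)) mod 4) , (b xor d)

record IsGroupIso {A B : Set} (_≈_ : A → A → Set) (_∙_ : A → A → A)
                  (_·_ : B → B → B) (φ : A → B) : Set where
  field
    resp  : ∀ x y → x ≈ y → φ x ≡ φ y
    homo  : ∀ x y → φ (x ∙ y) ≡ φ x · φ y
    inj   : ∀ x y → φ x ≡ φ y → x ≈ y
    surj  : ∀ b → Σ A λ x → φ x ≡ b

_≈A_ : ∀ {n} → GAut n → GAut n → Set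
σ ≈A τ = ∀ x → fun σ x ≡ fun τ x

_≈S_ : ∀ {n} → Stab n → Stab n → Set
σ ≈S τ = proj₁ σ ≈A proj₁ τ

record IsAutAction (n : ℕ) (ρ : D8 → V n → V n) : Set where
  field
    act-unit : ∀ z → ρ (Data.Fin.zero , false) z ≡ z
    act-mul  : ∀ d d' z → ρ (d ·D8 d') z ≡ ρ d (ρ d' z)
    act-hom  : ∀ d z w → ρ d (z ⊕ w) ≡ ρ d z ⊕ ρ d w

semiMul : ∀ {n} → (D8 → V n → V n) → (V n × D8) → (V n × D8) → (V n × D8)
semiMul ρ (z , d) (z' , d') = (z ⊕ ρ d z') , (d ·D8 d')

module Submission where

-- The neighbourhood S of 0 induces a "ladder": the path F 0 — … — F (n-1)
-- of suffix vectors F j = e_{j+1} + … + e_n, with a triangle F i — U i —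
-- F (i+1) on each edge, U i = e_{i+1}.  Its ends (F 0, U 0, F (n-1),
-- U (n-2)) are characterised graph-theoretically, so every automorphism of
-- the ladder is one of eight symmetries indexed by D8, and each of these
-- extends to a linear map of Z_2^n preserving S.
--
-- An automorphism σ of AQ_n fixing 0 induces an automorphism of the ladder,
-- i.e. agrees on S with some linear symmetry.  Composing with the inverse
-- of that symmetry gives an automorphism fixing 0 and S pointwise, which is
-- the identity by a local rigidity argument propagated along all of Z_2^n.
-- Hence every automorphism is affine, x ↦ A x + σ(0) with A one of the
-- eight linear symmetries; the three claims of the theorem follow.

open import Defs
open import Data.Bool using (Bool; true; false; _xor_; _∧_; not; T; if_then_else_)
open import Data.Bool.Properties
  using (xor-comm; xor-assoc; xor-identityˡ; xor-identityʳ; xor-same; ∧-zeroʳ; ∧-distribʳ-xor; true-xor; not-involutive)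
  renaming (_≟_ to _≟ᵇ_)
open import Data.Nat using (ℕ; zero; suc; _+_; _∸_; _≤_; _<_; z≤n; s≤s; _≤ᵇ_; _<ᵇ_; _≡ᵇ_; _≤?_; _≟_)
open import Data.Nat.Properties
open import Data.Fin using (Fin; zero; suc; toℕ; fromℕ<; #_)
open import Data.Fin.Properties using (all?; toℕ-injective; toℕ-fromℕ<; toℕ<n) renaming (_≟_ to _≟ᶠ_)
open import Data.List using (List; []; _∷_)
open import Data.Vec using ([]; _∷_; tabulate)
open import Data.Vec.Properties using (zipWith-comm; zipWith-assoc; zipWith-identityˡ; zipWith-identityʳ)
open import Data.Product using (Σ; _×_; _,_; proj₁; proj₂)
open import Data.Product.Properties using (≡-dec)
open import Data.Sum using (_⊎_; inj₁; inj₂)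
open import Data.Empty using (⊥; ⊥-elim)
open import Relation.Nullary using (Dec; yes; no; ¬_)
open import Relation.Nullary.Decidable using (map′; from-yes; ⌊_⌋; ¬?; _×-dec_; _→-dec_)
open import Relation.Unary using (Decidable)
open import Relation.Binary.Definitions using (tri<; tri≈; tri>)
open import Relation.Binary.PropositionalEquality

∀-Bool? : ∀ {P : Bool → Set} → Decidable P → Dec (∀ b → P b)
∀-Bool? P? with P? false | P? true
... | yes f | yes t = yes λ { false → f ; true → t }
... | no ¬f | _     = no λ h → ¬f (h false)
... | yes _ | no ¬t = no λ h → ¬t (h true)

∀-D8? : ∀ {P : D8 → Set} → Decidable P → Dec (∀ d → P d)
∀-D8? P? = map′ (λ h d → h (proj₁ d) (proj₂ d)) (λ h a b → h (a , b))
                (all? λ a → ∀-Bool? λ b → P? (a , b))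

≤ᵇ-true : ∀ {a b} → a ≤ b → (a ≤ᵇ b) ≡ true
≤ᵇ-true {a} {b} p with a ≤ᵇ b | ≤⇒≤ᵇ p
... | true | _ = refl

≤ᵇ-sound : ∀ a b → (a ≤ᵇ b) ≡ true → a ≤ b
≤ᵇ-sound a b e = ≤ᵇ⇒≤ a b (subst T (sym e) _)

≤ᵇ-false : ∀ {a b} → b < a → (a ≤ᵇ b) ≡ false
≤ᵇ-false {a} {b} p with a ≤ᵇ b in eq
... | false = refl
... | true  with () ← <⇒≱ p (≤ᵇ-sound a b eq)

≡ᵇ-true : ∀ {a b} → a ≡ b → (a ≡ᵇ b) ≡ true
≡ᵇ-true {a} {b} p with a ≡ᵇ b | ≡⇒≡ᵇ a b p
... | true | _ = refl

≡ᵇ-sound : ∀ a b → (a ≡ᵇ b) ≡ true → a ≡ b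
≡ᵇ-sound a b e = ≡ᵇ⇒≡ a b (subst T (sym e) _)

≡ᵇ-false : ∀ {a b} → a ≢ b → (a ≡ᵇ b) ≡ false
≡ᵇ-false {a} {b} ne with a ≡ᵇ b in eq
... | false = refl
... | true  with () ← ne (≡ᵇ-sound a b eq)

≡ᵇ-refl : ∀ a → (a ≡ᵇ a) ≡ true
≡ᵇ-refl a = ≡ᵇ-true {a} refl

≡ᵇ-sym : ∀ a b → (a ≡ᵇ b) ≡ (b ≡ᵇ a)
≡ᵇ-sym zero    zero    = refl
≡ᵇ-sym zero    (suc b) = refl
≡ᵇ-sym (suc a) zero    = refl
≡ᵇ-sym (suc a) (suc b) = ≡ᵇ-sym a b

<ᵇ-suc : ∀ q k → (q <ᵇ suc k) ≡ (q <ᵇ k) xor (k ≡ᵇ q)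
<ᵇ-suc zero    zero    = refl
<ᵇ-suc zero    (suc k) = refl
<ᵇ-suc (suc q) zero    = refl
<ᵇ-suc (suc q) (suc k) = <ᵇ-suc q k

<ᵇ-irrefl : ∀ k → (k <ᵇ k) ≡ false
<ᵇ-irrefl zero    = refl
<ᵇ-irrefl (suc k) = <ᵇ-irrefl k

-- Reflection q ↦ a - q of {0, …, a} seen through the boolean comparisons
-- (the coordinate permutation underlying the reversal of the ladder).

≤ᵇ-reflect : ∀ a j p → j ≤ suc a → p ≤ a → (j ≤ᵇ a ∸ p) ≡ not (suc a ∸ j ≤ᵇ p)
≤ᵇ-reflect a j p pj pp with j ≤? a ∸ p
... | yes h = trans (≤ᵇ-true h) (cong not (sym (≤ᵇ-false p<1+a∸j)))
  where p<1+a∸j : p < suc a ∸ j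
        p<1+a∸j = m+n≤o⇒m≤o∸n (suc p) (s≤s (subst (_≤ a) (+-comm j p) (m≤o∸n⇒m+n≤o j pp h)))
... | no h = trans (≤ᵇ-false (≰⇒> h)) (cong not (sym (≤ᵇ-true 1+a∸j≤p)))
  where 1+a∸j≤p : suc a ∸ j ≤ p
        1+a∸j≤p = m≤n+o⇒m∸n≤o (suc a) j (subst (_≤ j + p) (cong suc (m∸n+n≡m pp)) (+-monoˡ-≤ p (≰⇒> h)))

≡ᵇ-reflect : ∀ a i p → i ≤ a → p ≤ a → (i ≡ᵇ a ∸ p) ≡ (a ∸ i ≡ᵇ p)
≡ᵇ-reflect a i p pi pp with i ≟ a ∸ p
... | yes refl = trans (≡ᵇ-refl i) (sym (≡ᵇ-true (m∸[m∸n]≡n pp)))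
... | no  i≢   = trans (≡ᵇ-false i≢)
                       (sym (≡ᵇ-false {a ∸ i} {p} λ e → i≢ (trans (sym (m∸[m∸n]≡n pi)) (cong (a ∸_) e))))

xor-interchange : ∀ a b c d → (a xor b) xor (c xor d) ≡ (a xor c) xor (b xor d)
xor-interchange = from-yes (∀-Bool? λ a → ∀-Bool? λ b → ∀-Bool? λ c → ∀-Bool? λ d →
                    (a xor b) xor (c xor d) ≟ᵇ (a xor c) xor (b xor d))

xor-cancelʳ : ∀ a b → (a xor b) xor b ≡ a
xor-cancelʳ = from-yes (∀-Bool? λ a → ∀-Bool? λ b → (a xor b) xor b ≟ᵇ a)

if-true : ∀ {A : Set} {c} {x y : A} → c ≡ true → (if c then x else y) ≡ x
if-true refl = refl

if-false : ∀ {A : Set} {c} {x y : A} → c ≡ false → (if c then x else y) ≡ y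
if-false refl = refl

⊕-comm : ∀ {n} (x y : V n) → x ⊕ y ≡ y ⊕ x
⊕-comm = zipWith-comm xor-comm

⊕-assoc : ∀ {n} (x y z : V n) → (x ⊕ y) ⊕ z ≡ x ⊕ (y ⊕ z)
⊕-assoc = zipWith-assoc xor-assoc

⊕-identityˡ : ∀ {n} (x : V n) → zeroV ⊕ x ≡ x
⊕-identityˡ = zipWith-identityˡ xor-identityˡ

⊕-identityʳ : ∀ {n} (x : V n) → x ⊕ zeroV ≡ x
⊕-identityʳ = zipWith-identityʳ xor-identityʳ

⊕-self : ∀ {n} (x : V n) → x ⊕ x ≡ zeroV
⊕-self []      = refl
⊕-self (a ∷ x) = cong₂ _∷_ (xor-same a) (⊕-self x)

⊕-cancelˡ : ∀ {n} (x y : V n) → x ⊕ (x ⊕ y) ≡ y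
⊕-cancelˡ x y = begin
  x ⊕ (x ⊕ y)  ≡⟨ ⊕-assoc x x y ⟨
  (x ⊕ x) ⊕ y  ≡⟨ cong (_⊕ y) (⊕-self x) ⟩
  zeroV ⊕ y    ≡⟨ ⊕-identityˡ y ⟩
  y            ∎ where open ≡-Reasoning

⊕-cancelʳ : ∀ {n} (x y : V n) → (x ⊕ y) ⊕ y ≡ x
⊕-cancelʳ x y = begin
  (x ⊕ y) ⊕ y  ≡⟨ ⊕-assoc x y y ⟩
  x ⊕ (y ⊕ y)  ≡⟨ cong (x ⊕_) (⊕-self y) ⟩
  x ⊕ zeroV    ≡⟨ ⊕-identityʳ x ⟩
  x            ∎ where open ≡-Reasoning

⊕-swap : ∀ {n} (x y z : V n) → x ⊕ (y ⊕ z) ≡ y ⊕ (x ⊕ z)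
⊕-swap x y z = begin
  x ⊕ (y ⊕ z)  ≡⟨ ⊕-assoc x y z ⟨
  (x ⊕ y) ⊕ z  ≡⟨ cong (_⊕ z) (⊕-comm x y) ⟩
  (y ⊕ x) ⊕ z  ≡⟨ ⊕-assoc y x z ⟩
  y ⊕ (x ⊕ z)  ∎ where open ≡-Reasoning

⊕-cancel-common : ∀ {n} (x y z : V n) → (x ⊕ z) ⊕ (y ⊕ z) ≡ x ⊕ y
⊕-cancel-common x y z = begin
  (x ⊕ z) ⊕ (y ⊕ z)  ≡⟨ ⊕-assoc x z (y ⊕ z) ⟩
  x ⊕ (z ⊕ (y ⊕ z))  ≡⟨ cong (x ⊕_) (⊕-swap z y z) ⟩
  x ⊕ (y ⊕ (z ⊕ z))  ≡⟨ cong (λ v → x ⊕ (y ⊕ v)) (⊕-self z) ⟩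
  x ⊕ (y ⊕ zeroV)    ≡⟨ cong (x ⊕_) (⊕-identityʳ y) ⟩
  x ⊕ y              ∎ where open ≡-Reasoning

⊕-move : ∀ {n} (x y z : V n) → x ⊕ z ≡ y → x ≡ y ⊕ z
⊕-move x y z e = trans (sym (⊕-cancelʳ x z)) (cong (_⊕ z) e)

⊕-injʳ : ∀ {n} (x y z : V n) → x ⊕ z ≡ y ⊕ z → x ≡ y
⊕-injʳ x y z e = trans (⊕-move x (y ⊕ z) z e) (⊕-cancelʳ y z)

additive-zero : ∀ {n} (f : V n → V n) → (∀ x y → f (x ⊕ y) ≡ f x ⊕ f y) → f zeroV ≡ zeroV
additive-zero f hom = begin
  f zeroV                          ≡⟨ ⊕-cancelˡ (f zeroV) (f zeroV) ⟨
  f zeroV ⊕ (f zeroV ⊕ f zeroV)    ≡⟨ cong (f zeroV ⊕_) (hom zeroV zeroV) ⟨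
  f zeroV ⊕ f (zeroV ⊕ zeroV)      ≡⟨ cong (λ v → f zeroV ⊕ f v) (⊕-self zeroV) ⟩
  f zeroV ⊕ f zeroV                ≡⟨ ⊕-self (f zeroV) ⟩
  zeroV                            ∎ where open ≡-Reasoning

-- Coordinates.  'bit x q' is the q-th coordinate of x (false beyond the
-- length), and 'mk n g' is the vector with coordinates g 0, …, g (n-1).

bit : ∀ {n} → V n → ℕ → Bool
bit []      q       = false
bit (a ∷ x) zero    = a
bit (a ∷ x) (suc q) = bit x q

mk : ∀ n → (ℕ → Bool) → V n
mk zero    g = []
mk (suc n) g = g 0 ∷ mk n (λ q → g (suc q))

bit-mk : ∀ n g q → q < n → bit (mk n g) q ≡ g q
bit-mk (suc n) g zero    _       = refl
bit-mk (suc n) g (suc q) (s≤s p) = bit-mk n (λ q → g (suc q)) q p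

bit-ext : ∀ {n} (x y : V n) → (∀ q → q < n → bit x q ≡ bit y q) → x ≡ y
bit-ext []      []      h = refl
bit-ext (a ∷ x) (b ∷ y) h =
  cong₂ _∷_ (h 0 (s≤s z≤n)) (bit-ext x y (λ q p → h (suc q) (s≤s p)))

bit-⊕ : ∀ {n} (x y : V n) q → bit (x ⊕ y) q ≡ bit x q xor bit y q
bit-⊕ []      []      q       = refl
bit-⊕ (a ∷ x) (b ∷ y) zero    = refl
bit-⊕ (a ∷ x) (b ∷ y) (suc q) = bit-⊕ x y q

bit-zero : ∀ {n} q → bit (zeroV {n}) q ≡ false
bit-zero {zero}  q       = refl
bit-zero {suc n} zero    = refl
bit-zero {suc n} (suc q) = bit-zero {n} q

bit-tabulate : ∀ {n} (f : Fin n → Bool) q (p : q < n) → bit (tabulate f) q ≡ f (fromℕ< p)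
bit-tabulate {suc n} f zero    p       = refl
bit-tabulate {suc n} f (suc q) (s≤s p) = bit-tabulate (λ i → f (suc i)) q p

⌊≟ᶠ⌋-toℕ : ∀ {n} (i k : Fin n) → ⌊ i ≟ᶠ k ⌋ ≡ (toℕ i ≡ᵇ toℕ k)
⌊≟ᶠ⌋-toℕ i k with i ≟ᶠ k
... | yes refl = sym (≡ᵇ-refl (toℕ i))
... | no  i≢k  = sym (≡ᵇ-false (λ e → i≢k (toℕ-injective e)))

firstOne : ∀ {n} → V n → ℕ
firstOne []          = 0
firstOne (true ∷ x)  = 0
firstOne (false ∷ x) = suc (firstOne x)

firstOne-mk : ∀ n g j → j < n → g j ≡ true → (∀ q → q < j → g q ≡ false) →
              firstOne (mk n g) ≡ j
firstOne-mk (suc n) g zero    p       e h rewrite e = refl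
firstOne-mk (suc n) g (suc j) (s≤s p) e h rewrite h 0 (s≤s z≤n) =
  cong suc (firstOne-mk n (λ q → g (suc q)) j p e (λ q r → h (suc q) (s≤s r)))

-- Every vector is a sum of unit vectors.  'prefix k x' keeps the first k
-- coordinates of x; passing from k to k+1 adds the k-th unit vector when
-- x_k = 1.  This yields an induction principle for properties of V n.

unit : ∀ n → ℕ → V n
unit n k = mk n (k ≡ᵇ_)

prefix : ∀ n → ℕ → V n → V n
prefix n k x = mk n (λ q → (q <ᵇ k) ∧ bit x q)

prefix-zero : ∀ n x → prefix n 0 x ≡ zeroV
prefix-zero n x = bit-ext _ _ λ q p → trans (bit-mk n _ q p) (sym (bit-zero {n} q))

prefix-full : ∀ n x → prefix n n x ≡ x
prefix-full n x = bit-ext _ _ λ q p → trans (bit-mk n _ q p) (cong (_∧ bit x q) (≤ᵇ-true p))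

prefix-skip : ∀ n k x → bit x k ≡ false → prefix n (suc k) x ≡ prefix n k x
prefix-skip n k x xₖ = bit-ext _ _ λ q p →
  trans (bit-mk n _ q p) (trans (coordinate q) (sym (bit-mk n _ q p)))
  where
  coordinate : ∀ q → ((q <ᵇ suc k) ∧ bit x q) ≡ ((q <ᵇ k) ∧ bit x q)
  coordinate q rewrite <ᵇ-suc q k with k ≟ q
  ... | yes refl rewrite xₖ = trans (∧-zeroʳ _) (sym (∧-zeroʳ _))
  ... | no  k≢q  rewrite ≡ᵇ-false k≢q | xor-identityʳ (q <ᵇ k) = refl

prefix-add : ∀ n k x → bit x k ≡ true → prefix n (suc k) x ≡ unit n k ⊕ prefix n k x
prefix-add n k x xₖ = bit-ext _ _ λ q p → begin
  bit (prefix n (suc k) x) q                            ≡⟨ bit-mk n _ q p ⟩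
  (q <ᵇ suc k) ∧ bit x q                                ≡⟨ coordinate q ⟩
  (k ≡ᵇ q) xor ((q <ᵇ k) ∧ bit x q)                     ≡⟨ cong₂ _xor_ (bit-mk n _ q p) (bit-mk n _ q p) ⟨
  bit (unit n k) q xor bit (prefix n k x) q             ≡⟨ bit-⊕ (unit n k) (prefix n k x) q ⟨
  bit (unit n k ⊕ prefix n k x) q                       ∎
  where
  open ≡-Reasoning
  coordinate : ∀ q → ((q <ᵇ suc k) ∧ bit x q) ≡ ((k ≡ᵇ q) xor ((q <ᵇ k) ∧ bit x q))
  coordinate q rewrite <ᵇ-suc q k with k ≟ q
  ... | yes refl rewrite xₖ | <ᵇ-irrefl k | ≡ᵇ-refl k = refl
  ... | no  k≢q  rewrite ≡ᵇ-false k≢q | xor-identityʳ (q <ᵇ k) = refl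

V-induction : ∀ {n} (P : V n → Set) → P zeroV → (∀ k x → k < n → P x → P (unit n k ⊕ x)) → ∀ x → P x
V-induction {n} P P₀ step x = subst P (prefix-full n x) (prefixes n ≤-refl)
  where
  prefixes : ∀ k → k ≤ n → P (prefix n k x)
  prefixes zero    _ = subst P (sym (prefix-zero n x)) P₀
  prefixes (suc k) k<n with bit x k in xₖ
  ... | false = subst P (sym (prefix-skip n k x xₖ)) (prefixes k (<⇒≤ k<n))
  ... | true  = subst P (sym (prefix-add n k x xₖ)) (step k _ k<n (prefixes k (<⇒≤ k<n)))

-- The ladder graph on S (see below) has four "ends", labelled by Fin 4:
-- 0 = F 0 (all ones), 1 = F (n-1) (= e_n), 2 = U 0 (= e_1), 3 = U (n-2) (= e_{n-1}).
-- D8 acts on these labels through its rotation part, r^a s^b · ℓ = the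
-- rotation part of r^a s^b r^ℓ.

act : D8 → Fin 4 → Fin 4
act d ℓ = proj₁ (d ·D8 (ℓ , false))

_≟D8_ : (d d' : D8) → Dec (d ≡ d')
_≟D8_ = ≡-dec _≟ᶠ_ _≟ᵇ_

act-mul : ∀ d d' ℓ → act (d ·D8 d') ℓ ≡ act d (act d' ℓ)
act-mul = from-yes (∀-D8? λ d → ∀-D8? λ d' → all? λ ℓ →
                      act (d ·D8 d') ℓ ≟ᶠ act d (act d' ℓ))

-- Labels 0,2 (resp. 1,3) lie in the same end-triangle of the ladder;
-- 'partner' exchanges the two ends of one triangle, and D8 respects this.
partner : Fin 4 → Fin 4
partner ℓ = act (# 2 , false) ℓ

act-partner : ∀ d ℓ → act d (partner ℓ) ≡ partner (act d ℓ)
act-partner = from-yes (∀-D8? λ d → all? λ ℓ → act d (partner ℓ) ≟ᶠ partner (act d ℓ))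

-- whether a label sits at the far end of the ladder, and whether an
-- element of D8 exchanges the two end-triangles
farEnd : Fin 4 → Bool
farEnd zero                   = false
farEnd (suc zero)             = true
farEnd (suc (suc zero))       = false
farEnd (suc (suc (suc zero))) = true

reverses : D8 → Bool
reverses d = farEnd (act d (# 0))

-- Generators: swap₀ exchanges the ends 0 and 2, swap₁ exchanges 1 and 3,
-- flip reverses the ladder (0 ↔ 1, 2 ↔ 3).  Every element of D8 is given
-- by an explicit word in them.

data Gen : Set where
  swap₀ swap₁ flip : Gen

gact : Gen → Fin 4 → Fin 4
gact swap₀ ℓ = act (# 2 , true) ℓ
gact swap₁ ℓ = act (# 0 , true) ℓ
gact flip  ℓ = act (# 1 , true) ℓ

wact : List Gen → Fin 4 → Fin 4
wact []      ℓ = ℓ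
wact (g ∷ w) ℓ = gact g (wact w ℓ)

isFlip : Gen → Bool
isFlip flip = true
isFlip _    = false

flips : List Gen → Bool
flips []      = false
flips (g ∷ w) = isFlip g xor flips w

word : D8 → List Gen
word (zero , false)                   = []
word (suc zero , false)               = flip ∷ swap₁ ∷ []
word (suc (suc zero) , false)         = swap₀ ∷ swap₁ ∷ []
word (suc (suc (suc zero)) , false)   = flip ∷ swap₀ ∷ []
word (zero , true)                    = swap₁ ∷ []
word (suc zero , true)                = flip ∷ []
word (suc (suc zero) , true)          = swap₀ ∷ []
word (suc (suc (suc zero)) , true)    = flip ∷ swap₀ ∷ swap₁ ∷ []

wact-word : ∀ d ℓ → wact (word d) ℓ ≡ act d ℓ
wact-word = from-yes (∀-D8? λ d → all? λ ℓ → wact (word d) ℓ ≟ᶠ act d ℓ)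

flips-word : ∀ d → flips (word d) ≡ reverses d
flips-word = from-yes (∀-D8? λ d → flips (word d) ≟ᵇ reverses d)

fromEnds : Fin 4 → Fin 4 → D8
fromEnds zero                   (suc (suc (suc zero))) = # 0 , true
fromEnds (suc zero)             zero                   = # 1 , true
fromEnds (suc (suc zero))       (suc zero)             = # 2 , true
fromEnds (suc (suc (suc zero))) (suc (suc zero))       = # 3 , true
fromEnds ℓ₀                     _                      = ℓ₀ , false

fromEnds-act : ∀ d → fromEnds (act d (# 0)) (act d (# 1)) ≡ d
fromEnds-act = from-yes (∀-D8? λ d → fromEnds (act d (# 0)) (act d (# 1)) ≟D8 d)

act-fromEnds : ∀ ℓ₀ ℓ₁ → ℓ₁ ≢ ℓ₀ → ℓ₁ ≢ partner ℓ₀ →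
               (act (fromEnds ℓ₀ ℓ₁) (# 0) ≡ ℓ₀) × (act (fromEnds ℓ₀ ℓ₁) (# 1) ≡ ℓ₁)
act-fromEnds = from-yes (all? λ ℓ₀ → all? λ ℓ₁ →
  ¬? (ℓ₁ ≟ᶠ ℓ₀) →-dec ¬? (ℓ₁ ≟ᶠ partner ℓ₀) →-dec
  (act (fromEnds ℓ₀ ℓ₁) (# 0) ≟ᶠ ℓ₀) ×-dec (act (fromEnds ℓ₀ ℓ₁) (# 1) ≟ᶠ ℓ₁))

reverses-no-fixed-end : ∀ d ℓ → reverses d ≡ true → act d ℓ ≢ ℓ
reverses-no-fixed-end = from-yes (∀-D8? λ d → all? λ ℓ →
  (reverses d ≟ᵇ true) →-dec ¬? (act d ℓ ≟ᶠ ℓ))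

identity-criterion : ∀ d → reverses d ≡ false → act d (# 0) ≢ # 2 → act d (# 1) ≢ # 3 →
                     d ≡ (# 0 , false)
identity-criterion = from-yes (∀-D8? λ d →
  (reverses d ≟ᵇ false) →-dec ¬? (act d (# 0) ≟ᶠ # 2) →-dec ¬? (act d (# 1) ≟ᶠ # 3) →-dec
  (d ≟D8 (# 0 , false)))

-- S consists of the 2n-1
-- vectors  F j = e_{j+1} + … + e_n  (0 ≤ j ≤ n-1)  and  U i = e_{i+1}
-- (0 ≤ i ≤ n-2); note e_n = F (n-1).  'profile u q' is coordinate q of u.

data Ix : Set where
  F U : ℕ → Ix

profile : Ix → ℕ → Bool
profile (F j) q = j ≤ᵇ q
profile (U i) q = i ≡ᵇ q

-- The ladder: the graph induced by AQ_n on S (proved below).  It is a path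
-- F 0 — F 1 — … — F (n-1) together with a triangle F i — U i — F (i+1) on
-- every edge of the path.

Link : Ix → Ix → Set
Link (F j) (F k) = (k ≡ suc j) ⊎ (j ≡ suc k)
Link (F j) (U i) = (j ≡ i) ⊎ (j ≡ suc i)
Link (U i) (F j) = (j ≡ i) ⊎ (j ≡ suc i)
Link (U i) (U k) = ⊥

Link-sym : ∀ u v → Link u v → Link v u
Link-sym (F j) (F k) (inj₁ e) = inj₂ e
Link-sym (F j) (F k) (inj₂ e) = inj₁ e
Link-sym (F j) (U i) l        = l
Link-sym (U i) (F j) l        = l

-- the triangle identity F j + F (j+1) = U j, coordinatewise
triangle-profile : ∀ j q → ((j ≤ᵇ q) xor (suc j ≤ᵇ q)) ≡ (j ≡ᵇ q)
triangle-profile j q with <-cmp j q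
... | tri< j<q _ _ rewrite ≤ᵇ-true (<⇒≤ j<q) | ≤ᵇ-true j<q | ≡ᵇ-false (<⇒≢ j<q) = refl
... | tri≈ _ refl _ rewrite ≤ᵇ-true (≤-refl {j}) | ≤ᵇ-false (n<1+n j) | ≡ᵇ-refl j = refl
... | tri> _ _ q<j rewrite ≤ᵇ-false q<j | ≤ᵇ-false (m<n⇒m<1+n q<j)
                         | ≡ᵇ-false (≢-sym (<⇒≢ q<j)) = refl

-- The connection set and its ladder in dimension n = t + 2 (valid for all
-- n ≥ 2): encoding of the indices, membership in S, and adjacency.
module Ladder (t : ℕ) where

  N top : ℕ
  N   = suc (suc t)
  top = suc t

  Valid : Ix → Set
  Valid (F j) = j ≤ top
  Valid (U i) = i ≤ t

  enc : Ix → V N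
  enc u = mk N (profile u)

  bit-enc : ∀ u q → q < N → bit (enc u) q ≡ profile u q
  bit-enc u q = bit-mk N (profile u) q

  enc-ext : ∀ (x : V N) u → (∀ q → q < N → bit x q ≡ profile u q) → x ≡ enc u
  enc-ext x u h = bit-ext x (enc u) (λ q p → trans (h q p) (sym (bit-enc u q p)))

  F<N : ∀ {j} → j ≤ top → j < N
  F<N = s≤s
  U<N : ∀ {i} → i ≤ t → i < N
  U<N p = s≤s (m≤n⇒m≤1+n p)
  top<N : top < N
  top<N = ≤-refl

  -- the last coordinate separates the F's (value true) from the U's (false)
  U-top : ∀ {i} → i ≤ t → (i ≡ᵇ top) ≡ false
  U-top p = ≡ᵇ-false (<⇒≢ (s≤s p))

  at : ∀ u v w {a b c} q → q < N → enc u ⊕ enc v ≡ enc w →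
       profile u q ≡ a → profile v q ≡ b → profile w q ≡ c → a xor b ≡ c
  at u v w q p e refl refl refl = begin
    profile u q xor profile v q          ≡⟨ cong₂ _xor_ (bit-enc u q p) (bit-enc v q p) ⟨
    bit (enc u) q xor bit (enc v) q      ≡⟨ bit-⊕ (enc u) (enc v) q ⟨
    bit (enc u ⊕ enc v) q                ≡⟨ cong (λ x → bit x q) e ⟩
    bit (enc w) q                        ≡⟨ bit-enc w q p ⟩
    profile w q                          ∎ where open ≡-Reasoning

  at-eq : ∀ u w q → q < N → enc u ≡ enc w → profile u q ≡ profile w q
  at-eq u w q p e = trans (sym (bit-enc u q p)) (trans (cong (λ x → bit x q) e) (bit-enc w q p))

  enc-injective : ∀ u v → Valid u → Valid v → enc u ≡ enc v → u ≡ v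
  enc-injective (F j) (F k) pj pk e = cong F (≤-antisym
    (≤ᵇ-sound j k (trans (at-eq (F j) (F k) k (F<N pk) e) (≤ᵇ-true (≤-refl {k}))))
    (≤ᵇ-sound k j (trans (sym (at-eq (F j) (F k) j (F<N pj) e)) (≤ᵇ-true (≤-refl {j})))))
  enc-injective (F j) (U i) pj pi e
    with () ← trans (sym (≤ᵇ-true pj)) (trans (at-eq (F j) (U i) top top<N e) (U-top pi))
  enc-injective (U i) (F j) pi pj e
    with () ← trans (sym (U-top pi)) (trans (at-eq (U i) (F j) top top<N e) (≤ᵇ-true pj))
  enc-injective (U i) (U k) pi pk e =
    cong U (sym (≡ᵇ-sound k i (trans (sym (at-eq (U i) (U k) i (U<N pi) e)) (≡ᵇ-refl i))))

  -- Reading the last coordinate, the number of F's among u, v, u + v is even;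
  -- the remaining cases are settled by reading one or two more coordinates.

  FF-sum : ∀ j k i → j < k → k ≤ top → enc (F j) ⊕ enc (F k) ≡ enc (U i) → k ≡ suc j
  FF-sum j k i j<k pk e
    with refl ← ≡ᵇ-sound i j (sym (at (F j) (F k) (U i) j (<-trans j<k (F<N pk)) e
                                     (≤ᵇ-true (≤-refl {j})) (≤ᵇ-false j<k) refl))
    with k ≟ suc i
  ... | yes k≡ = k≡
  ... | no  k≢
    with i+1<k ← ≤∧≢⇒< j<k (≢-sym k≢)
    with () ← at (F i) (F k) (U i) (suc i) (<-trans i+1<k (F<N pk)) e
                 (≤ᵇ-true (n≤1+n i)) (≤ᵇ-false i+1<k) (≡ᵇ-false (<⇒≢ (n<1+n i)))

  FU-sum-below : ∀ j i k → j < i → j ≤ top → i ≤ t → ¬ (enc (F j) ⊕ enc (U i) ≡ enc (F k))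
  FU-sum-below j i k j<i pj pi e
    with k≤j ← ≤ᵇ-sound k j (sym (at (F j) (U i) (F k) j (F<N pj) e
                 (≤ᵇ-true (≤-refl {j})) (≡ᵇ-false (≢-sym (<⇒≢ j<i))) refl))
    with () ← at (F j) (U i) (F k) i (U<N pi) e (≤ᵇ-true (<⇒≤ j<i)) (≡ᵇ-refl i)
                 (≤ᵇ-true (≤-trans k≤j (<⇒≤ j<i)))

  FU-sum-above : ∀ j i k → suc i < j → j ≤ top → i ≤ t → ¬ (enc (F j) ⊕ enc (U i) ≡ enc (F k))
  FU-sum-above j i k i+1<j pj pi e
    with k≤i ← ≤ᵇ-sound k i (sym (at (F j) (U i) (F k) i (U<N pi) e
                 (≤ᵇ-false (<-trans (n<1+n i) i+1<j)) (≡ᵇ-refl i) refl))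
    with () ← at (F j) (U i) (F k) (suc i) (<-trans i+1<j (F<N pj)) e
                 (≤ᵇ-false i+1<j) (≡ᵇ-false (<⇒≢ (n<1+n i))) (≤ᵇ-true (≤-trans k≤i (n≤1+n i)))

  FU-sum : ∀ j i k → j ≤ top → i ≤ t → enc (F j) ⊕ enc (U i) ≡ enc (F k) → Link (F j) (U i)
  FU-sum j i k pj pi e with <-cmp j i
  ... | tri≈ _ j≡i _ = inj₁ j≡i
  ... | tri< j<i _ _ with () ← FU-sum-below j i k j<i pj pi e
  ... | tri> _ _ i<j with j ≟ suc i
  ...   | yes j≡ = inj₂ j≡
  ...   | no  j≢ with () ← FU-sum-above j i k (≤∧≢⇒< i<j (≢-sym j≢)) pj pi e

  UU-sum : ∀ i k l → i ≤ t → k ≤ t → l ≤ t → ¬ (enc (U i) ⊕ enc (U k) ≡ enc (U l))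
  UU-sum i k l pi pk pl e with i ≟ k
  ... | yes refl with () ← trans (sym (xor-same (i ≡ᵇ l)))
                                 (at (U i) (U i) (U l) l (U<N pl) e refl refl (≡ᵇ-refl l))
  ... | no  i≢k
    with refl ← ≡ᵇ-sound l k (sym (at (U i) (U k) (U l) k (U<N pk) e (≡ᵇ-false i≢k) (≡ᵇ-refl k) refl))
    with () ← at (U i) (U k) (U l) i (U<N pi) e (≡ᵇ-refl i) (≡ᵇ-false (≢-sym i≢k)) (≡ᵇ-false (≢-sym i≢k))

  sum⇒Link : ∀ u v w → Valid u → Valid v → Valid w → enc u ⊕ enc v ≡ enc w → Link u v
  sum⇒Link (F j) (F k) (F l) pu pv pw e
    with () ← at (F j) (F k) (F l) top top<N e (≤ᵇ-true pu) (≤ᵇ-true pv) (≤ᵇ-true pw)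
  sum⇒Link (F j) (F k) (U i) pu pv pw e with <-cmp j k
  ... | tri< j<k _ _ = inj₁ (FF-sum j k i j<k pv e)
  ... | tri> _ _ k<j = inj₂ (FF-sum k j i k<j pu (trans (⊕-comm (enc (F k)) (enc (F j))) e))
  ... | tri≈ _ refl _ with () ← trans (sym (xor-same (j ≤ᵇ i)))
                                      (at (F j) (F j) (U i) i (U<N pw) e refl refl (≡ᵇ-refl i))
  sum⇒Link (F j) (U i) (F k) pu pv pw e = FU-sum j i k pu pv e
  sum⇒Link (F j) (U i) (U k) pu pv pw e
    with () ← at (F j) (U i) (U k) top top<N e (≤ᵇ-true pu) (U-top pv) (U-top pw)
  sum⇒Link (U i) (F j) (F k) pu pv pw e = FU-sum j i k pv pu (trans (⊕-comm (enc (F j)) (enc (U i))) e)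
  sum⇒Link (U i) (F j) (U k) pu pv pw e
    with () ← at (U i) (F j) (U k) top top<N e (U-top pu) (≤ᵇ-true pv) (U-top pw)
  sum⇒Link (U i) (U k) (F l) pu pv pw e
    with () ← at (U i) (U k) (F l) top top<N e (U-top pu) (U-top pv) (≤ᵇ-true pw)
  sum⇒Link (U i) (U k) (U l) pu pv pw e with () ← UU-sum i k l pu pv pw e

  triangle : ∀ j → enc (F j) ⊕ enc (F (suc j)) ≡ enc (U j)
  triangle j = enc-ext _ (U j) λ q p → begin
    bit (enc (F j) ⊕ enc (F (suc j))) q                ≡⟨ bit-⊕ (enc (F j)) (enc (F (suc j))) q ⟩
    bit (enc (F j)) q xor bit (enc (F (suc j))) q      ≡⟨ cong₂ _xor_ (bit-enc (F j) q p) (bit-enc (F (suc j)) q p) ⟩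
    (j ≤ᵇ q) xor (suc j ≤ᵇ q)                          ≡⟨ triangle-profile j q ⟩
    (j ≡ᵇ q)                                           ∎ where open ≡-Reasoning

  triangle-FU : ∀ j → enc (F j) ⊕ enc (U j) ≡ enc (F (suc j))
  triangle-FU j = trans (cong (enc (F j) ⊕_) (sym (triangle j))) (⊕-cancelˡ (enc (F j)) (enc (F (suc j))))

  triangle-UF : ∀ j → enc (U j) ⊕ enc (F (suc j)) ≡ enc (F j)
  triangle-UF j = trans (cong (_⊕ enc (F (suc j))) (sym (triangle j))) (⊕-cancelʳ (enc (F j)) (enc (F (suc j))))

  InSum : Ix → Ix → Set
  InSum u v = Σ Ix λ w → Valid w × (enc u ⊕ enc v ≡ enc w)

  InSum-sym : ∀ u v → InSum u v → InSum v u
  InSum-sym u v (w , pw , e) = w , pw , trans (⊕-comm (enc v) (enc u)) e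

  FU-Link⇒sum : ∀ j i → i ≤ t → Link (F j) (U i) → InSum (F j) (U i)
  FU-Link⇒sum j i pi (inj₁ refl) = F (suc j) , s≤s pi , triangle-FU j
  FU-Link⇒sum j i pi (inj₂ refl) = InSum-sym (U i) (F j) (F i , m≤n⇒m≤1+n pi , triangle-UF i)

  Link⇒sum : ∀ u v → Valid u → Valid v → Link u v → InSum u v
  Link⇒sum (F j) (F k) pu pv (inj₁ refl) = U j , ≤-pred pv , triangle j
  Link⇒sum (F j) (F k) pu pv (inj₂ refl) = InSum-sym (F k) (F j) (U k , ≤-pred pu , triangle k)
  Link⇒sum (F j) (U i) pu pv l           = FU-Link⇒sum j i pv l
  Link⇒sum (U i) (F j) pu pv l           = InSum-sym (F j) (U i) (FU-Link⇒sum j i pu l)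

  bit-unit : ∀ (i : Fin N) q → q < N → bit (unitV i) q ≡ (toℕ i ≡ᵇ q)
  bit-unit i q p = begin
    bit (unitV i) q                ≡⟨ bit-tabulate (λ k → ⌊ i ≟ᶠ k ⌋) q p ⟩
    ⌊ i ≟ᶠ fromℕ< p ⌋              ≡⟨ ⌊≟ᶠ⌋-toℕ i (fromℕ< p) ⟩
    (toℕ i ≡ᵇ toℕ (fromℕ< p))      ≡⟨ cong (toℕ i ≡ᵇ_) (toℕ-fromℕ< p) ⟩
    (toℕ i ≡ᵇ q)                   ∎ where open ≡-Reasoning

  bit-suffix : ∀ k q → q < N → bit (suffixV N k) q ≡ (N ∸ k ≤ᵇ q)
  bit-suffix k q p = trans (bit-tabulate (λ (j : Fin N) → N ∸ k ≤ᵇ toℕ j) q p) (cong (N ∸ k ≤ᵇ_) (toℕ-fromℕ< p))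

  -- e_n is both a unit vector and a suffix
  top-unit : ∀ q → q < N → (top ≡ᵇ q) ≡ (top ≤ᵇ q)
  top-unit q p with m≤n⇒m<n∨m≡n (≤-pred p)
  ... | inj₁ q<top = trans (≡ᵇ-false (≢-sym (<⇒≢ q<top))) (sym (≤ᵇ-false q<top))
  ... | inj₂ refl  = trans (≡ᵇ-refl top) (sym (≤ᵇ-true (≤-refl {top})))

  S⇒enc : ∀ s → InS N s → Σ Ix λ w → Valid w × (s ≡ enc w)
  S⇒enc s (inj₁ (i , e)) with toℕ i ≟ top
  ... | yes i≡top = F top , ≤-refl , trans e (enc-ext _ (F top) λ q p →
                      trans (bit-unit i q p) (trans (cong (_≡ᵇ q) i≡top) (top-unit q p)))
  ... | no  i≢top = U (toℕ i) , ≤-pred (≤∧≢⇒< (≤-pred (toℕ<n i)) i≢top) ,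
                    trans e (enc-ext _ (U (toℕ i)) (bit-unit i))
  S⇒enc s (inj₂ (k , 2≤k , k≤N , e)) =
    F (N ∸ k) , ∸-monoʳ-≤ N (≤-trans (s≤s z≤n) 2≤k) , trans e (enc-ext _ (F (N ∸ k)) (bit-suffix k))

  enc∈S : ∀ w → Valid w → InS N (enc w)
  enc∈S (F j) pj with m≤n⇒m<n∨m≡n pj
  ... | inj₁ j<top = inj₂ (N ∸ j , 2≤N∸j , m∸n≤m N j , sym (enc-ext _ (F j) λ q p →
                       trans (bit-suffix (N ∸ j) q p) (cong (_≤ᵇ q) (m∸[m∸n]≡n (m≤n⇒m≤1+n pj)))))
    where 2≤N∸j : 2 ≤ N ∸ j
          2≤N∸j = subst (_≤ N ∸ j) (m+n∸n≡m 2 t) (∸-monoʳ-≤ N (≤-pred j<top))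
  ... | inj₂ refl = inj₁ (fromℕ< top<N , sym (enc-ext _ (F top) λ q p →
                      trans (bit-unit (fromℕ< top<N) q p)
                            (trans (cong (_≡ᵇ q) (toℕ-fromℕ< top<N)) (top-unit q p))))
  enc∈S (U i) pi = inj₁ (fromℕ< (U<N pi) , sym (enc-ext _ (U i) λ q p →
                     trans (bit-unit (fromℕ< (U<N pi)) q p) (cong (_≡ᵇ q) (toℕ-fromℕ< (U<N pi)))))

  unit-in-S : ∀ k → k < N → Σ Ix λ u → Valid u × (unit N k ≡ enc u)
  unit-in-S k k<N with k ≟ top
  ... | yes refl = F top , ≤-refl , enc-ext _ (F top) λ q p → trans (bit-mk N (top ≡ᵇ_) q p) (top-unit q p)
  ... | no  k≢   = U k , ≤-pred (≤∧≢⇒< (≤-pred k<N) k≢) , enc-ext _ (U k) λ q p → bit-mk N (k ≡ᵇ_) q p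

  Link⇒Adj : ∀ u v → Valid u → Valid v → Link u v → Adj N (enc u) (enc v)
  Link⇒Adj u v pu pv l with Link⇒sum v u pv pu (Link-sym u v l)
  ... | w , pw , e = enc w , enc∈S w pw , ⊕-move (enc v) (enc w) (enc u) e

  Adj⇒Link : ∀ u v → Valid u → Valid v → Adj N (enc u) (enc v) → Link u v
  Adj⇒Link u v pu pv (s , s∈S , e) with S⇒enc s s∈S
  ... | w , pw , refl = Link-sym v u (sum⇒Link v u w pv pu pw (sym (⊕-move (enc w) (enc v) (enc u) (sym e))))

  decode : V N → Ix
  decode v = if bit v top then F (firstOne v) else U (firstOne v)

  decode-enc : ∀ u → Valid u → decode (enc u) ≡ u
  decode-enc (F j) pj rewrite bit-enc (F j) top top<N | ≤ᵇ-true pj =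
    cong F (firstOne-mk N (profile (F j)) j (F<N pj) (≤ᵇ-true (≤-refl {j})) (λ q q<j → ≤ᵇ-false q<j))
  decode-enc (U i) pi rewrite bit-enc (U i) top top<N | U-top pi =
    cong U (firstOne-mk N (profile (U i)) i (U<N pi) (≡ᵇ-refl i) (λ q q<i → ≡ᵇ-false (≢-sym (<⇒≢ q<i))))

-- The
-- ends and the inner vertices are distinguished graph-theoretically, the
-- images of the ends F 0 and F (n-1) determine d, and the remaining
-- vertices follow along the path of F's.

module LadderAut (m : ℕ) where

  t : ℕ
  t = suc (suc m)

  open Ladder t public

  end : Fin 4 → Ix
  end zero                   = F 0
  end (suc zero)             = F top
  end (suc (suc zero))       = U 0
  end (suc (suc (suc zero))) = U t

  end-valid : ∀ ℓ → Valid (end ℓ)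
  end-valid zero                   = z≤n
  end-valid (suc zero)             = ≤-refl
  end-valid (suc (suc zero))       = z≤n
  end-valid (suc (suc (suc zero))) = ≤-refl

  endLabel : Ix → Fin 4
  endLabel (F zero)    = # 0
  endLabel (F (suc _)) = # 1
  endLabel (U zero)    = # 2
  endLabel (U (suc _)) = # 3

  endLabel-end : ∀ ℓ → endLabel (end ℓ) ≡ ℓ
  endLabel-end zero                   = refl
  endLabel-end (suc zero)             = refl
  endLabel-end (suc (suc zero))       = refl
  endLabel-end (suc (suc (suc zero))) = refl

  end-injective : ∀ ℓ ℓ' → end ℓ ≡ end ℓ' → ℓ ≡ ℓ'
  end-injective ℓ ℓ' e = trans (sym (endLabel-end ℓ)) (trans (cong endLabel e) (endLabel-end ℓ'))

  end-partner : ∀ ℓ → Link (end ℓ) (end (partner ℓ))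
  end-partner zero                   = inj₁ refl
  end-partner (suc zero)             = inj₂ refl
  end-partner (suc (suc zero))       = inj₁ refl
  end-partner (suc (suc (suc zero))) = inj₂ refl

  linked-ends : ∀ ℓ ℓ' → Link (end ℓ) (end ℓ') → ℓ' ≡ partner ℓ
  linked-ends zero                   (suc (suc zero))       _ = refl
  linked-ends (suc zero)             (suc (suc (suc zero))) _ = refl
  linked-ends (suc (suc zero))       zero                   _ = refl
  linked-ends (suc (suc (suc zero))) (suc zero)             _ = refl
  linked-ends zero                   zero                   (inj₁ ())
  linked-ends zero                   zero                   (inj₂ ())
  linked-ends zero                   (suc zero)             (inj₁ ())
  linked-ends zero                   (suc zero)             (inj₂ ())
  linked-ends zero                   (suc (suc (suc zero))) (inj₁ ())
  linked-ends zero                   (suc (suc (suc zero))) (inj₂ ())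
  linked-ends (suc zero)             zero                   (inj₁ ())
  linked-ends (suc zero)             zero                   (inj₂ ())
  linked-ends (suc zero)             (suc zero)             (inj₁ ())
  linked-ends (suc zero)             (suc zero)             (inj₂ ())
  linked-ends (suc zero)             (suc (suc zero))       (inj₁ ())
  linked-ends (suc zero)             (suc (suc zero))       (inj₂ ())
  linked-ends (suc (suc zero))       (suc zero)             (inj₁ ())
  linked-ends (suc (suc zero))       (suc zero)             (inj₂ ())
  linked-ends (suc (suc (suc zero))) zero                   (inj₁ ())
  linked-ends (suc (suc (suc zero))) zero                   (inj₂ ())
  linked-ends (suc (suc zero))       (suc (suc zero))       ()
  linked-ends (suc (suc zero))       (suc (suc (suc zero))) ()
  linked-ends (suc (suc (suc zero))) (suc (suc zero))       ()
  linked-ends (suc (suc (suc zero))) (suc (suc (suc zero))) ()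

  Simplicial : Ix → Set
  Simplicial u = ∀ v w → Valid v → Valid w → Link u v → Link u w → (v ≡ w) ⊎ Link v w

  IsEnd : Ix → Set
  IsEnd u = Simplicial u × Σ Ix λ v → Valid v × Link u v × Simplicial v

  simplicial-pair : ∀ u a b → (∀ v → Valid v → Link u v → (v ≡ a) ⊎ (v ≡ b)) → Link a b → Simplicial u
  simplicial-pair u a b nb ab v w pv pw uv uw with nb v pv uv | nb w pw uw
  ... | inj₁ refl | inj₁ refl = inj₁ refl
  ... | inj₁ refl | inj₂ refl = inj₂ ab
  ... | inj₂ refl | inj₁ refl = inj₂ (Link-sym a b ab)
  ... | inj₂ refl | inj₂ refl = inj₁ refl

  U-neighbours : ∀ i v → Link (U i) v → (v ≡ F i) ⊎ (v ≡ F (suc i))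
  U-neighbours i (F j) (inj₁ refl) = inj₁ refl
  U-neighbours i (F j) (inj₂ refl) = inj₂ refl

  U-simplicial : ∀ i → Simplicial (U i)
  U-simplicial i = simplicial-pair (U i) (F i) (F (suc i)) (λ v _ → U-neighbours i v) (inj₁ refl)

  F0-simplicial : Simplicial (F 0)
  F0-simplicial = simplicial-pair (F 0) (F 1) (U 0) nb (inj₂ refl)
    where
    nb : ∀ v → Valid v → Link (F 0) v → (v ≡ F 1) ⊎ (v ≡ U 0)
    nb (F k) _ (inj₁ refl) = inj₁ refl
    nb (U i) _ (inj₁ refl) = inj₂ refl

  Ftop-simplicial : Simplicial (F top)
  Ftop-simplicial = simplicial-pair (F top) (F t) (U t) nb (inj₁ refl)
    where
    nb : ∀ v → Valid v → Link (F top) v → (v ≡ F t) ⊎ (v ≡ U t)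
    nb (F k) pv (inj₁ refl) = ⊥-elim (1+n≰n pv)
    nb (F k) pv (inj₂ refl) = inj₁ refl
    nb (U i) pv (inj₁ refl) = ⊥-elim (1+n≰n pv)
    nb (U i) pv (inj₂ refl) = inj₂ refl

  end-simplicial : ∀ ℓ → Simplicial (end ℓ)
  end-simplicial zero                   = F0-simplicial
  end-simplicial (suc zero)             = Ftop-simplicial
  end-simplicial (suc (suc zero))       = U-simplicial 0
  end-simplicial (suc (suc (suc zero))) = U-simplicial t

  end-isEnd : ∀ ℓ → IsEnd (end ℓ)
  end-isEnd ℓ = end-simplicial ℓ , end (partner ℓ) , end-valid (partner ℓ) , end-partner ℓ ,
                end-simplicial (partner ℓ)

  InnerF InnerU : ℕ → Set
  InnerF x = (1 ≤ x) × (x ≤ t)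
  InnerU x = (1 ≤ x) × (x ≤ suc m)

  innerF-valid : ∀ {x} → InnerF x → Valid (F x)
  innerF-valid (_ , p) = m≤n⇒m≤1+n p
  innerU-valid : ∀ {x} → InnerU x → Valid (U x)
  innerU-valid (_ , p) = m≤n⇒m≤1+n p

  -- an inner F x has the unlinked neighbours F (x-1), F (x+1)
  innerF-not-simplicial : ∀ x → InnerF x → ¬ Simplicial (F x)
  innerF-not-simplicial (suc k) (_ , px) s
    with s (F k) (F (suc (suc k))) (≤-trans (n≤1+n k) (m≤n⇒m≤1+n px)) (s≤s px) (inj₂ refl) (inj₁ refl)
  ... | inj₁ ()
  ... | inj₂ (inj₁ ())
  ... | inj₂ (inj₂ ())

  -- an inner U x has only inner F's as neighbours
  innerU-not-end : ∀ x → InnerU x → ¬ IsEnd (U x)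
  innerU-not-end x (1≤x , x≤) (_ , v , _ , l , sv) with U-neighbours x v l
  ... | inj₁ refl = innerF-not-simplicial x (1≤x , m≤n⇒m≤1+n x≤) sv
  ... | inj₂ refl = innerF-not-simplicial (suc x) (s≤s z≤n , s≤s x≤) sv

  data Kind (u : Ix) : Set where
    isEnd    : (ℓ : Fin 4) → u ≡ end ℓ → Kind u
    isInnerF : (x : ℕ) → u ≡ F x → InnerF x → Kind u
    isInnerU : (x : ℕ) → u ≡ U x → InnerU x → Kind u

  kind : ∀ u → Valid u → Kind u
  kind (F zero)    _ = isEnd (# 0) refl
  kind (F (suc k)) p with m≤n⇒m<n∨m≡n p
  ... | inj₁ lt = isInnerF (suc k) refl (s≤s z≤n , ≤-pred lt)
  ... | inj₂ e  = isEnd (# 1) (cong F e)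
  kind (U zero)    _ = isEnd (# 2) refl
  kind (U (suc k)) p with m≤n⇒m<n∨m≡n p
  ... | inj₁ lt = isInnerU (suc k) refl (s≤s z≤n , ≤-pred lt)
  ... | inj₂ e  = isEnd (# 3) (cong U e)

  record Automorphism : Set where
    field
      to from  : Ix → Ix
      to-valid   : ∀ u → Valid u → Valid (to u)
      from-valid : ∀ u → Valid u → Valid (from u)
      from-to    : ∀ u → Valid u → from (to u) ≡ u
      to-from    : ∀ u → Valid u → to (from u) ≡ u
      to-link    : ∀ u v → Valid u → Valid v → Link u v → Link (to u) (to v)
      to-link⁻¹  : ∀ u v → Valid u → Valid v → Link (to u) (to v) → Link u v

  inverse : Automorphism → Automorphism
  inverse A = record
    { to = from ; from = to ; to-valid = from-valid ; from-valid = to-valid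
    ; from-to = to-from ; to-from = from-to
    ; to-link = λ u v pu pv l → to-link⁻¹ (from u) (from v) (from-valid u pu) (from-valid v pv)
                                  (subst₂ Link (sym (to-from u pu)) (sym (to-from v pv)) l)
    ; to-link⁻¹ = λ u v pu pv l → subst₂ Link (to-from u pu) (to-from v pv)
                                    (to-link (from u) (from v) (from-valid u pu) (from-valid v pv) l) }
    where open Automorphism A

  module _ (A : Automorphism) where
    open Automorphism A

    to-injective : ∀ u v → Valid u → Valid v → to u ≡ to v → u ≡ v
    to-injective u v pu pv e = trans (sym (from-to u pu)) (trans (cong from e) (from-to v pv))

    simplicial-reflect : ∀ u → Valid u → Simplicial (to u) → Simplicial u
    simplicial-reflect u pu s v w pv pw uv uw
      with s (to v) (to w) (to-valid v pv) (to-valid w pw) (to-link u v pu pv uv) (to-link u w pu pw uw)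
    ... | inj₁ e = inj₁ (to-injective v w pv pw e)
    ... | inj₂ l = inj₂ (to-link⁻¹ v w pv pw l)

  simplicial-preserve : ∀ A u → Valid u → Simplicial u → Simplicial (Automorphism.to A u)
  simplicial-preserve A u pu s = simplicial-reflect (inverse A) (to u) (to-valid u pu)
                                   (subst Simplicial (sym (from-to u pu)) s)
    where open Automorphism A

  isEnd-preserve : ∀ A u → Valid u → IsEnd u → IsEnd (Automorphism.to A u)
  isEnd-preserve A u pu (s , v , pv , l , sv) =
    simplicial-preserve A u pu s , to v , to-valid v pv , to-link u v pu pv l , simplicial-preserve A v pv sv
    where open Automorphism A

  isEnd-reflect : ∀ A u → Valid u → IsEnd (Automorphism.to A u) → IsEnd u
  isEnd-reflect A u pu e = subst IsEnd (from-to u pu) (isEnd-preserve (inverse A) (to u) (to-valid u pu) e)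
    where open Automorphism A

  module _ (A : Automorphism) where
    open Automorphism A

    end-image : ∀ ℓ → Σ (Fin 4) λ ℓ' → to (end ℓ) ≡ end ℓ'
    end-image ℓ with kind (to (end ℓ)) (to-valid (end ℓ) (end-valid ℓ))
    ... | isEnd ℓ' e = ℓ' , e
    ... | isInnerF x e ix = ⊥-elim (innerF-not-simplicial x ix
            (subst Simplicial e (simplicial-preserve A (end ℓ) (end-valid ℓ) (end-simplicial ℓ))))
    ... | isInnerU x e ix = ⊥-elim (innerU-not-end x ix
            (subst IsEnd e (isEnd-preserve A (end ℓ) (end-valid ℓ) (end-isEnd ℓ))))

    innerF-image : ∀ x → InnerF x → Σ ℕ λ y → (to (F x) ≡ F y) × InnerF y
    innerF-image x ix with kind (to (F x)) (to-valid (F x) (innerF-valid ix))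
    ... | isEnd ℓ e = ⊥-elim (innerF-not-simplicial x ix
            (simplicial-reflect A (F x) (innerF-valid ix) (subst Simplicial (sym e) (end-simplicial ℓ))))
    ... | isInnerF y e iy = y , e , iy
    ... | isInnerU y e iy = ⊥-elim (innerF-not-simplicial x ix
            (simplicial-reflect A (F x) (innerF-valid ix) (subst Simplicial (sym e) (U-simplicial y))))

    innerU-image : ∀ x → InnerU x → Σ ℕ λ y → (to (U x) ≡ U y) × InnerU y
    innerU-image x ix with kind (to (U x)) (to-valid (U x) (innerU-valid ix))
    ... | isEnd ℓ e = ⊥-elim (innerU-not-end x ix
            (isEnd-reflect A (U x) (innerU-valid ix) (subst IsEnd (sym e) (end-isEnd ℓ))))
    ... | isInnerF y e iy = ⊥-elim (innerF-not-simplicial y iy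
            (subst Simplicial e (simplicial-preserve A (U x) (innerU-valid ix) (U-simplicial x))))
    ... | isInnerU y e iy = y , e , iy

  reflectF reflectU : Bool → ℕ → ℕ
  reflectF b x = if b then top ∸ x else x
  reflectU b x = if b then t ∸ x else x

  genMap : Gen → Ix → Ix
  genMap swap₀ (F zero)    = U zero
  genMap swap₀ (F (suc j)) = F (suc j)
  genMap swap₀ (U zero)    = F zero
  genMap swap₀ (U (suc i)) = U (suc i)
  genMap swap₁ (F j)       = if j ≡ᵇ top then U t else F j
  genMap swap₁ (U i)       = if i ≡ᵇ t then F top else U i
  genMap flip  (F j)       = F (reflectF true j)
  genMap flip  (U i)       = U (reflectU true i)

  ladderMap : List Gen → Ix → Ix
  ladderMap []      u = u
  ladderMap (g ∷ w) u = genMap g (ladderMap w u)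

  ladderSym : D8 → Ix → Ix
  ladderSym d = ladderMap (word d)

  genMap-valid : ∀ g u → Valid u → Valid (genMap g u)
  genMap-valid swap₀ (F zero)    p = z≤n
  genMap-valid swap₀ (F (suc j)) p = p
  genMap-valid swap₀ (U zero)    p = z≤n
  genMap-valid swap₀ (U (suc i)) p = p
  genMap-valid swap₁ (F j)       p with j ≡ᵇ top
  ... | true  = ≤-refl
  ... | false = p
  genMap-valid swap₁ (U i)       p with i ≡ᵇ t
  ... | true  = ≤-refl
  ... | false = p
  genMap-valid flip  (F j)       p = m∸n≤m top j
  genMap-valid flip  (U i)       p = m∸n≤m t i

  ladderMap-valid : ∀ w u → Valid u → Valid (ladderMap w u)
  ladderMap-valid []      u p = p
  ladderMap-valid (g ∷ w) u p = genMap-valid g (ladderMap w u) (ladderMap-valid w u p)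

  genMap-end : ∀ g ℓ → genMap g (end ℓ) ≡ end (gact g ℓ)
  genMap-end swap₀ zero                   = refl
  genMap-end swap₀ (suc zero)             = refl
  genMap-end swap₀ (suc (suc zero))       = refl
  genMap-end swap₀ (suc (suc (suc zero))) = refl
  genMap-end swap₁ zero                   = refl
  genMap-end swap₁ (suc zero)             rewrite ≡ᵇ-refl top = refl
  genMap-end swap₁ (suc (suc zero))       = refl
  genMap-end swap₁ (suc (suc (suc zero))) rewrite ≡ᵇ-refl t = refl
  genMap-end flip  zero                   = refl
  genMap-end flip  (suc zero)             = cong F (n∸n≡0 top)
  genMap-end flip  (suc (suc zero))       = refl
  genMap-end flip  (suc (suc (suc zero))) = cong U (n∸n≡0 t)

  ladderMap-end : ∀ w ℓ → ladderMap w (end ℓ) ≡ end (wact w ℓ)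
  ladderMap-end []      ℓ = refl
  ladderMap-end (g ∷ w) ℓ = trans (cong (genMap g) (ladderMap-end w ℓ)) (genMap-end g (wact w ℓ))

  ladderSym-end : ∀ d ℓ → ladderSym d (end ℓ) ≡ end (act d ℓ)
  ladderSym-end d ℓ = trans (ladderMap-end (word d) ℓ) (cong end (wact-word d ℓ))

  genMap-innerF : ∀ g x → InnerF x → genMap g (F x) ≡ F (reflectF (isFlip g) x)
  genMap-innerF swap₀ (suc x) _       = refl
  genMap-innerF swap₁ x       (_ , p) rewrite ≡ᵇ-false {x} {top} (<⇒≢ (s≤s p)) = refl
  genMap-innerF flip  x       _       = refl

  genMap-innerU : ∀ g x → InnerU x → genMap g (U x) ≡ U (reflectU (isFlip g) x)
  genMap-innerU swap₀ (suc x) _       = refl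
  genMap-innerU swap₁ x       (_ , p) rewrite ≡ᵇ-false {x} {t} (<⇒≢ (s≤s p)) = refl
  genMap-innerU flip  x       _       = refl

  reflectF-inner : ∀ b x → InnerF x → InnerF (reflectF b x)
  reflectF-inner false x ix        = ix
  reflectF-inner true  x (1≤x , p) =
    subst (_≤ top ∸ x) (m+n∸n≡m 1 t) (∸-monoʳ-≤ top p) , ∸-monoʳ-≤ top 1≤x

  reflectU-inner : ∀ b x → InnerU x → InnerU (reflectU b x)
  reflectU-inner false x ix        = ix
  reflectU-inner true  x (1≤x , p) =
    subst (_≤ t ∸ x) (m+n∸n≡m 1 (suc m)) (∸-monoʳ-≤ t p) , ∸-monoʳ-≤ t 1≤x

  reflectF-comp : ∀ b c x → x ≤ top → reflectF b (reflectF c x) ≡ reflectF (b xor c) x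
  reflectF-comp false c     x _ = refl
  reflectF-comp true  false x _ = refl
  reflectF-comp true  true  x p = m∸[m∸n]≡n p

  reflectU-comp : ∀ b c x → x ≤ t → reflectU b (reflectU c x) ≡ reflectU (b xor c) x
  reflectU-comp false c     x _ = refl
  reflectU-comp true  false x _ = refl
  reflectU-comp true  true  x p = m∸[m∸n]≡n p

  ladderMap-innerF : ∀ w x → InnerF x → ladderMap w (F x) ≡ F (reflectF (flips w) x)
  ladderMap-innerF []      x ix = refl
  ladderMap-innerF (g ∷ w) x ix = begin
    genMap g (ladderMap w (F x))                   ≡⟨ cong (genMap g) (ladderMap-innerF w x ix) ⟩
    genMap g (F (reflectF (flips w) x))            ≡⟨ genMap-innerF g _ (reflectF-inner (flips w) x ix) ⟩
    F (reflectF (isFlip g) (reflectF (flips w) x))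
      ≡⟨ cong F (reflectF-comp (isFlip g) (flips w) x (innerF-valid ix)) ⟩
    F (reflectF (flips (g ∷ w)) x)                 ∎ where open ≡-Reasoning

  ladderMap-innerU : ∀ w x → InnerU x → ladderMap w (U x) ≡ U (reflectU (flips w) x)
  ladderMap-innerU []      x ix = refl
  ladderMap-innerU (g ∷ w) x ix = begin
    genMap g (ladderMap w (U x))                   ≡⟨ cong (genMap g) (ladderMap-innerU w x ix) ⟩
    genMap g (U (reflectU (flips w) x))            ≡⟨ genMap-innerU g _ (reflectU-inner (flips w) x ix) ⟩
    U (reflectU (isFlip g) (reflectU (flips w) x))
      ≡⟨ cong U (reflectU-comp (isFlip g) (flips w) x (innerU-valid ix)) ⟩
    U (reflectU (flips (g ∷ w)) x)                 ∎ where open ≡-Reasoning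

  ladderSym-innerF : ∀ d x → InnerF x → ladderSym d (F x) ≡ F (reflectF (reverses d) x)
  ladderSym-innerF d x ix = trans (ladderMap-innerF (word d) x ix) (cong (λ b → F (reflectF b x)) (flips-word d))

  ladderSym-innerU : ∀ d x → InnerU x → ladderSym d (U x) ≡ U (reflectU (reverses d) x)
  ladderSym-innerU d x ix = trans (ladderMap-innerU (word d) x ix) (cong (λ b → U (reflectU b x)) (flips-word d))

  innerF-linked-end : ∀ x ℓ → InnerF x → Link (F x) (end ℓ) → x ≡ reflectF (farEnd ℓ) 1
  innerF-linked-end x zero                   _              (inj₁ ())
  innerF-linked-end x zero                   _              (inj₂ e)    = e
  innerF-linked-end x (suc zero)             _              (inj₁ e)    = sym (suc-injective e)
  innerF-linked-end x (suc zero)             (_ , p)        (inj₂ refl) = ⊥-elim (1+n≰n (≤-trans (n≤1+n _) p))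
  innerF-linked-end x (suc (suc zero))       (() , _)       (inj₁ refl)
  innerF-linked-end x (suc (suc zero))       _              (inj₂ e)    = e
  innerF-linked-end x (suc (suc (suc zero))) _              (inj₁ e)    = e
  innerF-linked-end x (suc (suc (suc zero))) (_ , p)        (inj₂ refl) = ⊥-elim (1+n≰n p)

  reflectF-linked : ∀ b j y → suc (suc j) ≤ t → Link (F y) (F (reflectF b (suc j))) →
                    (y ≡ reflectF b (suc (suc j))) ⊎ (y ≡ reflectF b j)
  reflectF-linked false j y _ (inj₁ e) = inj₂ (sym (suc-injective e))
  reflectF-linked false j y _ (inj₂ e) = inj₁ e
  reflectF-linked true  j y p (inj₁ e) =
    inj₁ (sym (suc-injective (trans (sym (+-∸-assoc 1 (≤-pred (≤-pred (m≤n⇒m≤1+n p))))) e)))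
  reflectF-linked true  j y p (inj₂ e) =
    inj₂ (trans e (sym (+-∸-assoc 1 (≤-trans (n≤1+n j) (≤-trans (n≤1+n (suc j)) p)))))

  U-between : ∀ a y → Link (U y) (F a) → Link (U y) (F (suc a)) → y ≡ a
  U-between a y (inj₁ e)    _         = sym e
  U-between a y (inj₂ refl) (inj₁ ())
  U-between a y (inj₂ refl) (inj₂ ())

  module Classify (A : Automorphism) where
    open Automorphism A

    ladderClass : D8
    ladderClass = fromEnds (endLabel (to (end (# 0)))) (endLabel (to (end (# 1))))

    ℓ₀ ℓ₁ : Fin 4
    ℓ₀ = proj₁ (end-image A (# 0))
    ℓ₁ = proj₁ (end-image A (# 1))

    to-end₀ : to (F 0) ≡ end ℓ₀
    to-end₀ = proj₂ (end-image A (# 0))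
    to-end₁ : to (F top) ≡ end ℓ₁
    to-end₁ = proj₂ (end-image A (# 1))

    -- F 0 and F top are distinct and unlinked, and so are their images
    ℓ₁≢ℓ₀ : ℓ₁ ≢ ℓ₀
    ℓ₁≢ℓ₀ e with () ← to-injective A (F 0) (F top) z≤n ≤-refl
                          (trans to-end₀ (trans (cong end (sym e)) (sym to-end₁)))

    ℓ₁≢partner : ℓ₁ ≢ partner ℓ₀
    ℓ₁≢partner e with () ← linked-ends (# 0) (# 1) (to-link⁻¹ (F 0) (F top) z≤n ≤-refl
                     (subst₂ Link (sym to-end₀) (sym (trans to-end₁ (cong end e))) (end-partner ℓ₀)))

    ladderClass-ends : ladderClass ≡ fromEnds ℓ₀ ℓ₁
    ladderClass-ends = cong₂ fromEnds (trans (cong endLabel to-end₀) (endLabel-end ℓ₀))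
                                  (trans (cong endLabel to-end₁) (endLabel-end ℓ₁))

    act₀ : act ladderClass (# 0) ≡ ℓ₀
    act₀ = trans (cong (λ d → act d (# 0)) ladderClass-ends) (proj₁ (act-fromEnds ℓ₀ ℓ₁ ℓ₁≢ℓ₀ ℓ₁≢partner))
    act₁ : act ladderClass (# 1) ≡ ℓ₁
    act₁ = trans (cong (λ d → act d (# 1)) ladderClass-ends) (proj₂ (act-fromEnds ℓ₀ ℓ₁ ℓ₁≢ℓ₀ ℓ₁≢partner))

    -- the images of the other two ends are forced by the triangle links
    partner-image : ∀ ℓ → to (end ℓ) ≡ end (act ladderClass ℓ) →
                    to (end (partner ℓ)) ≡ end (act ladderClass (partner ℓ))
    partner-image ℓ e with end-image A (partner ℓ)
    ... | ℓ' , e' = trans e' (cong end (trans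
            (linked-ends (act ladderClass ℓ) ℓ' (subst₂ Link e e'
              (to-link (end ℓ) (end (partner ℓ)) (end-valid ℓ) (end-valid (partner ℓ)) (end-partner ℓ))))
            (sym (act-partner ladderClass ℓ))))

    ends : ∀ ℓ → to (end ℓ) ≡ end (act ladderClass ℓ)
    ends zero                   = trans to-end₀ (cong end (sym act₀))
    ends (suc zero)             = trans to-end₁ (cong end (sym act₁))
    ends (suc (suc zero))       = partner-image (# 0) (ends (# 0))
    ends (suc (suc (suc zero))) = partner-image (# 1) (ends (# 1))

    b : Bool
    b = reverses ladderClass

    F₁-image : to (F 1) ≡ F (reflectF b 1)
    F₁-image with innerF-image A 1 (s≤s z≤n , s≤s z≤n)
    ... | y , e , iy = trans e (cong F (innerF-linked-end y (act ladderClass (# 0)) iy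
            (subst₂ Link e (ends (# 0)) (to-link (F 1) (F 0) (s≤s z≤n) z≤n (inj₂ refl)))))

    -- walking along the path of inner F's; the image of F (j+2) is a
    -- neighbour of that of F (j+1) other than the image of F j
    F-image : ∀ j → suc j ≤ t → to (F (suc j)) ≡ F (reflectF b (suc j))
    F-image zero    _ = F₁-image
    F-image (suc j) p with innerF-image A (suc (suc j)) (s≤s z≤n , p)
    ... | y , e , iy with reflectF-linked b j y p (subst₂ Link e (F-image j (≤-trans (n≤1+n _) p))
                            (to-link (F (suc (suc j))) (F (suc j)) (m≤n⇒m≤1+n p)
                                     (≤-trans (n≤1+n _) (m≤n⇒m≤1+n p)) (inj₂ refl)))
    ...   | inj₁ y≡ = trans e (cong F y≡)
    ...   | inj₂ y≡ = ⊥-elim (not-backwards j p y iy y≡ e)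
      where
      not-backwards : ∀ j → suc (suc j) ≤ t → ∀ y → InnerF y → y ≡ reflectF b j → to (F (suc (suc j))) ≡ F y → ⊥
      not-backwards zero    _ y (1≤y , y≤t) refl _ with b
      ... | false with () ← 1≤y
      ... | true  = 1+n≰n y≤t
      not-backwards (suc j) p y _ refl e'
        with () ← to-injective A (F (suc (suc (suc j)))) (F (suc j)) (m≤n⇒m≤1+n p)
                    (≤-trans (n≤1+n _) (≤-trans (n≤1+n _) (m≤n⇒m≤1+n p)))
                    (trans e' (sym (F-image j (≤-trans (n≤1+n _) (≤-trans (n≤1+n _) p)))))

    innerF : ∀ x → InnerF x → to (F x) ≡ F (reflectF b x)
    innerF (suc j) (_ , p) = F-image j p

    innerU : ∀ x → InnerU x → to (U x) ≡ U (reflectU b x)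
    innerU x ix@(1≤x , x≤) with innerU-image A x ix
    ... | y , e , iy = trans e (cong U (position b link₁ link₂))
      where
      ix₁ : InnerF x
      ix₁ = 1≤x , m≤n⇒m≤1+n x≤
      ix₂ : InnerF (suc x)
      ix₂ = s≤s z≤n , s≤s x≤
      link₁ : Link (U y) (F (reflectF b x))
      link₁ = subst₂ Link e (innerF x ix₁) (to-link (U x) (F x) (innerU-valid ix) (innerF-valid ix₁) (inj₁ refl))
      link₂ : Link (U y) (F (reflectF b (suc x)))
      link₂ = subst₂ Link e (innerF (suc x) ix₂)
                (to-link (U x) (F (suc x)) (innerU-valid ix) (innerF-valid ix₂) (inj₂ refl))
      position : ∀ c → Link (U y) (F (reflectF c x)) → Link (U y) (F (reflectF c (suc x))) → y ≡ reflectU c x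
      position false l₁ l₂ = U-between x y l₁ l₂
      position true  l₁ l₂ = U-between (t ∸ x) y l₂ (subst (λ z → Link (U y) (F z)) (+-∸-assoc 1 (m≤n⇒m≤1+n x≤)) l₁)

    classify : ∀ u → Valid u → to u ≡ ladderSym ladderClass u
    classify u pu with kind u pu
    ... | isEnd ℓ refl      = trans (ends ℓ) (sym (ladderSym-end ladderClass ℓ))
    ... | isInnerF x refl ix = trans (innerF x ix) (sym (ladderSym-innerF ladderClass x ix))
    ... | isInnerU x refl ix = trans (innerU x ix) (sym (ladderSym-innerU ladderClass x ix))

-- Each generator g acts on
-- V n by a linear involution 'genLin g' defined coordinatewise:
--   swap₀ adds x₀ to every other coordinate,
--   swap₁ exchanges the coordinates n-2 and n-1,
--   flip  sends x to (x_{n-2} + x_{n-1}, …, x_0 + x_{n-1}, x_{n-1}).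
-- 'genLin g' maps S onto S exactly as 'genMap g' does, so every symmetry
-- of the ladder extends to an element of Aut(Z_2^n, S).

module Linear (m : ℕ) where

  open LadderAut m public

  nonzero : ℕ → Bool
  nonzero zero    = false
  nonzero (suc _) = true

  coord : Gen → (ℕ → Bool) → ℕ → Bool
  coord swap₀ b p = b p xor (b 0 ∧ nonzero p)
  coord swap₁ b p = if p ≡ᵇ t then b top else (if p ≡ᵇ top then b t else b p)
  coord flip  b p = if p ≡ᵇ top then b top else (b (t ∸ p) xor b top)

  genLin : Gen → V N → V N
  genLin g x = mk N (coord g (bit x))

  bit-genLin : ∀ g x q → q < N → bit (genLin g x) q ≡ coord g (bit x) q
  bit-genLin g x q = bit-mk N (coord g (bit x)) q

  t<N : t < N
  t<N = s≤s (n≤1+n t)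
  t∸p<N : ∀ p → t ∸ p < N
  t∸p<N p = s≤s (≤-trans (m∸n≤m t p) (n≤1+n t))

  below-top : ∀ q → q < N → (q ≡ᵇ top) ≡ false → q ≤ t
  below-top q p e with m≤n⇒m<n∨m≡n (≤-pred p)
  ... | inj₁ lt   = ≤-pred lt
  ... | inj₂ refl with () ← trans (sym e) (≡ᵇ-refl top)

  t≢top : (t ≡ᵇ top) ≡ false
  t≢top = ≡ᵇ-false (<⇒≢ (n<1+n t))
  top≢t : (top ≡ᵇ t) ≡ false
  top≢t = ≡ᵇ-false (≢-sym (<⇒≢ (n<1+n t)))

  coord-additive : ∀ g b c p → coord g (λ q → b q xor c q) p ≡ coord g b p xor coord g c p
  coord-additive swap₀ b c p =
    trans (cong ((b p xor c p) xor_) (∧-distribʳ-xor (nonzero p) (b 0) (c 0)))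
          (xor-interchange (b p) (c p) (b 0 ∧ nonzero p) (c 0 ∧ nonzero p))
  coord-additive swap₁ b c p with p ≡ᵇ t | p ≡ᵇ top
  ... | true  | _     = refl
  ... | false | true  = refl
  ... | false | false = refl
  coord-additive flip  b c p with p ≡ᵇ top
  ... | true  = refl
  ... | false = xor-interchange (b (t ∸ p)) (c (t ∸ p)) (b top) (c top)

  coord-cong : ∀ g {b c} → (∀ q → q < N → b q ≡ c q) → ∀ p → p < N → coord g b p ≡ coord g c p
  coord-cong swap₀ h p pp = cong₂ (λ x y → x xor (y ∧ nonzero p)) (h p pp) (h 0 (s≤s z≤n))
  coord-cong swap₁ h p pp with p ≡ᵇ t | p ≡ᵇ top
  ... | true  | _     = h top top<N
  ... | false | true  = h t t<N
  ... | false | false = h p pp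
  coord-cong flip  h p pp with p ≡ᵇ top
  ... | true  = h top top<N
  ... | false = cong₂ _xor_ (h (t ∸ p) (t∸p<N p)) (h top top<N)

  swap₁-at-t : ∀ b → coord swap₁ b t ≡ b top
  swap₁-at-t b = if-true (≡ᵇ-refl t)

  swap₁-at-top : ∀ b → coord swap₁ b top ≡ b t
  swap₁-at-top b = trans (if-false top≢t) (if-true (≡ᵇ-refl top))

  flip-at-top : ∀ b → coord flip b top ≡ b top
  flip-at-top b = if-true (≡ᵇ-refl top)

  flip-below : ∀ b p → (p ≡ᵇ top) ≡ false → coord flip b p ≡ b (t ∸ p) xor b top
  flip-below b p e = if-false e

  coord-involutive : ∀ g b p → p < N → coord g (coord g b) p ≡ b p
  coord-involutive swap₀ b p _ = swap₀-twice (b p) (b 0) (nonzero p)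
    where
    swap₀-twice : ∀ x y z → (x xor (y ∧ z)) xor ((y xor (y ∧ false)) ∧ z) ≡ x
    swap₀-twice = from-yes (∀-Bool? λ x → ∀-Bool? λ y → ∀-Bool? λ z →
                    (x xor (y ∧ z)) xor ((y xor (y ∧ false)) ∧ z) ≟ᵇ x)
  coord-involutive swap₁ b p _ with p ≡ᵇ t in e₁ | p ≡ᵇ top in e₂
  ... | true  | _     = trans (swap₁-at-top b) (cong b (sym (≡ᵇ-sound p t e₁)))
  ... | false | true  = trans (swap₁-at-t b) (cong b (sym (≡ᵇ-sound p top e₂)))
  ... | false | false = refl
  coord-involutive flip  b p pp with p ≡ᵇ top in e
  ... | true  = trans (flip-at-top b) (cong b (sym (≡ᵇ-sound p top e)))
  ... | false = begin
    coord flip b (t ∸ p) xor coord flip b top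
      ≡⟨ cong₂ _xor_ (flip-below b (t ∸ p) (≡ᵇ-false (<⇒≢ (s≤s (m∸n≤m t p))))) (flip-at-top b) ⟩
    (b (t ∸ (t ∸ p)) xor b top) xor b top
      ≡⟨ cong (λ q → (b q xor b top) xor b top) (m∸[m∸n]≡n (below-top p pp e)) ⟩
    (b p xor b top) xor b top
      ≡⟨ xor-cancelʳ (b p) (b top) ⟩
    b p ∎ where open ≡-Reasoning

  swap₁-fixes : ∀ b p → b t ≡ b top → coord swap₁ b p ≡ b p
  swap₁-fixes b p e with p ≡ᵇ t in e₁ | p ≡ᵇ top in e₂
  ... | true  | _     = trans (sym e) (cong b (sym (≡ᵇ-sound p t e₁)))
  ... | false | true  = trans e (cong b (sym (≡ᵇ-sound p top e₂)))
  ... | false | false = refl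

  swap₁-units : ∀ p → p < N → coord swap₁ (profile (F top)) p ≡ profile (U t) p
                            × coord swap₁ (profile (U t)) p ≡ profile (F top) p
  swap₁-units p pp with p ≡ᵇ t in e₁ | p ≡ᵇ top in e₂
  ... | true  | _     with refl ← ≡ᵇ-sound p t e₁ =
    trans (≤ᵇ-true (≤-refl {top})) (sym (≡ᵇ-refl t)) , trans t≢top (sym (≤ᵇ-false (n<1+n t)))
  ... | false | true  with refl ← ≡ᵇ-sound p top e₂ =
    trans (≤ᵇ-false (n<1+n t)) (sym t≢top) , trans (≡ᵇ-refl t) (sym (≤ᵇ-true (≤-refl {top})))
  ... | false | false = trans p<top (sym t≢p) , trans t≢p (sym p<top)
    where p<top : (top ≤ᵇ p) ≡ false
          p<top = ≤ᵇ-false (s≤s (below-top p pp e₂))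
          t≢p : (t ≡ᵇ p) ≡ false
          t≢p = trans (≡ᵇ-sym t p) e₁

  coord-profile : ∀ g u → Valid u → ∀ p → p < N → coord g (profile u) p ≡ profile (genMap g u) p
  coord-profile swap₀ (F zero)    _  zero    _ = refl
  coord-profile swap₀ (F zero)    _  (suc p) _ = refl
  coord-profile swap₀ (F (suc j)) _  p       _ = xor-identityʳ _
  coord-profile swap₀ (U zero)    _  zero    _ = refl
  coord-profile swap₀ (U zero)    _  (suc p) _ = refl
  coord-profile swap₀ (U (suc i)) _  p       _ = xor-identityʳ _
  coord-profile swap₁ (F j)       pj p       pp with j ≟ top
  ... | no  j≢top = trans (swap₁-fixes (profile (F j)) p
                            (trans (≤ᵇ-true (≤-pred (≤∧≢⇒< pj j≢top))) (sym (≤ᵇ-true pj))))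
                          (cong (λ u → profile u p) (sym (if-false (≡ᵇ-false j≢top))))
  ... | yes refl  = trans (proj₁ (swap₁-units p pp)) (cong (λ u → profile u p) (sym (if-true (≡ᵇ-refl top))))
  coord-profile swap₁ (U i)       pi p       pp with i ≟ t
  ... | no  i≢t   = trans (swap₁-fixes (profile (U i)) p (trans (≡ᵇ-false i≢t) (sym (U-top pi))))
                          (cong (λ u → profile u p) (sym (if-false (≡ᵇ-false i≢t))))
  ... | yes refl  = trans (proj₂ (swap₁-units p pp)) (cong (λ u → profile u p) (sym (if-true (≡ᵇ-refl t))))
  coord-profile flip  (F j)       pj p       pp with p ≡ᵇ top in e
  ... | true  with refl ← ≡ᵇ-sound p top e = trans (≤ᵇ-true pj) (sym (≤ᵇ-true (m∸n≤m top j)))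
  ... | false = begin
    (j ≤ᵇ t ∸ p) xor (j ≤ᵇ top)     ≡⟨ cong ((j ≤ᵇ t ∸ p) xor_) (≤ᵇ-true pj) ⟩
    (j ≤ᵇ t ∸ p) xor true           ≡⟨ trans (xor-comm _ true) (true-xor _) ⟩
    not (j ≤ᵇ t ∸ p)                ≡⟨ cong not (≤ᵇ-reflect t j p pj (below-top p pp e)) ⟩
    not (not (top ∸ j ≤ᵇ p))        ≡⟨ not-involutive _ ⟩
    (top ∸ j ≤ᵇ p)                  ∎ where open ≡-Reasoning
  coord-profile flip  (U i)       pi p       pp with p ≡ᵇ top in e
  ... | true  with refl ← ≡ᵇ-sound p top e = trans (U-top pi) (sym (U-top (m∸n≤m t i)))
  ... | false = trans (cong ((i ≡ᵇ t ∸ p) xor_) (U-top pi))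
                      (trans (xor-identityʳ _) (≡ᵇ-reflect t i p pi (below-top p pp e)))

  genLin-additive : ∀ g x y → genLin g (x ⊕ y) ≡ genLin g x ⊕ genLin g y
  genLin-additive g x y = bit-ext _ _ λ q p → begin
    bit (genLin g (x ⊕ y)) q                          ≡⟨ bit-genLin g (x ⊕ y) q p ⟩
    coord g (bit (x ⊕ y)) q                           ≡⟨ coord-cong g (λ q _ → bit-⊕ x y q) q p ⟩
    coord g (λ q → bit x q xor bit y q) q             ≡⟨ coord-additive g (bit x) (bit y) q ⟩
    coord g (bit x) q xor coord g (bit y) q           ≡⟨ cong₂ _xor_ (bit-genLin g x q p) (bit-genLin g y q p) ⟨
    bit (genLin g x) q xor bit (genLin g y) q         ≡⟨ bit-⊕ (genLin g x) (genLin g y) q ⟨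
    bit (genLin g x ⊕ genLin g y) q                   ∎ where open ≡-Reasoning

  genLin-involutive : ∀ g x → genLin g (genLin g x) ≡ x
  genLin-involutive g x = bit-ext _ _ λ q p → begin
    bit (genLin g (genLin g x)) q      ≡⟨ bit-genLin g (genLin g x) q p ⟩
    coord g (bit (genLin g x)) q       ≡⟨ coord-cong g (bit-genLin g x) q p ⟩
    coord g (coord g (bit x)) q        ≡⟨ coord-involutive g (bit x) q p ⟩
    bit x q                            ∎ where open ≡-Reasoning

  genLin-enc : ∀ g u → Valid u → genLin g (enc u) ≡ enc (genMap g u)
  genLin-enc g u pu = enc-ext _ (genMap g u) λ q p → begin
    bit (genLin g (enc u)) q           ≡⟨ bit-genLin g (enc u) q p ⟩
    coord g (bit (enc u)) q            ≡⟨ coord-cong g (bit-enc u) q p ⟩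
    coord g (profile u) q              ≡⟨ coord-profile g u pu q p ⟩
    profile (genMap g u) q             ∎ where open ≡-Reasoning

  -- Words: 'lin w' applies the generators of w (last letter first) and
  -- 'linInv w' undoes it; likewise 'ladderMapInv w' on indices.
  lin linInv : List Gen → V N → V N
  lin []      x = x
  lin (g ∷ w) x = genLin g (lin w x)
  linInv []      x = x
  linInv (g ∷ w) x = linInv w (genLin g x)

  ladderMapInv : List Gen → Ix → Ix
  ladderMapInv []      u = u
  ladderMapInv (g ∷ w) u = ladderMapInv w (genMap g u)

  ladderMapInv-valid : ∀ w u → Valid u → Valid (ladderMapInv w u)
  ladderMapInv-valid []      u p = p
  ladderMapInv-valid (g ∷ w) u p = ladderMapInv-valid w (genMap g u) (genMap-valid g u p)

  lin-additive : ∀ w x y → lin w (x ⊕ y) ≡ lin w x ⊕ lin w y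
  lin-additive []      x y = refl
  lin-additive (g ∷ w) x y = trans (cong (genLin g) (lin-additive w x y)) (genLin-additive g (lin w x) (lin w y))

  linInv-additive : ∀ w x y → linInv w (x ⊕ y) ≡ linInv w x ⊕ linInv w y
  linInv-additive []      x y = refl
  linInv-additive (g ∷ w) x y =
    trans (cong (linInv w) (genLin-additive g x y)) (linInv-additive w (genLin g x) (genLin g y))

  lin-linInv : ∀ w x → lin w (linInv w x) ≡ x
  lin-linInv []      x = refl
  lin-linInv (g ∷ w) x = trans (cong (genLin g) (lin-linInv w (genLin g x))) (genLin-involutive g x)

  linInv-lin : ∀ w x → linInv w (lin w x) ≡ x
  linInv-lin []      x = refl
  linInv-lin (g ∷ w) x = trans (cong (linInv w) (genLin-involutive g (lin w x))) (linInv-lin w x)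

  lin-enc : ∀ w u → Valid u → lin w (enc u) ≡ enc (ladderMap w u)
  lin-enc []      u p = refl
  lin-enc (g ∷ w) u p =
    trans (cong (genLin g) (lin-enc w u p)) (genLin-enc g (ladderMap w u) (ladderMap-valid w u p))

  linInv-enc : ∀ w u → Valid u → linInv w (enc u) ≡ enc (ladderMapInv w u)
  linInv-enc []      u p = refl
  linInv-enc (g ∷ w) u p =
    trans (cong (linInv w) (genLin-enc g u p)) (linInv-enc w (genMap g u) (genMap-valid g u p))

inverseAut : ∀ {n} → GAut n → GAut n
inverseAut σ = record
  { fun = inv σ ; inv = fun σ ; fun-inv = inv-fun σ ; inv-fun = fun-inv σ
  ; pres  = λ x y a → refl- σ (inv σ x) (inv σ y) (subst₂ (Adj _) (sym (fun-inv σ x)) (sym (fun-inv σ y)) a)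
  ; refl- = λ x y a → subst₂ (Adj _) (fun-inv σ x) (fun-inv σ y) (pres σ _ _ a) }

translation : ∀ {n} → V n → GAut n
translation z = record
  { fun = _⊕ z ; inv = _⊕ z
  ; fun-inv = λ x → ⊕-cancelʳ x z ; inv-fun = λ x → ⊕-cancelʳ x z
  ; pres  = λ { x y (s , s∈S , e) → s , s∈S , trans (cong (_⊕ z) e) (⊕-assoc s x z) }
  ; refl- = λ { x y (s , s∈S , e) → s , s∈S , ⊕-injʳ y (s ⊕ x) z (trans e (sym (⊕-assoc s x z))) } }

affine : ∀ {n} → GrpAutS n → V n → GAut n
affine {n} α z = record
  { fun = λ x → afun α x ⊕ z
  ; inv = λ x → ainv α (x ⊕ z)
  ; fun-inv = λ x → trans (cong (_⊕ z) (afun-inv α (x ⊕ z))) (⊕-cancelʳ x z)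
  ; inv-fun = λ x → trans (cong (ainv α) (⊕-cancelʳ (afun α x) z)) (ainv-fun α x)
  ; pres  = λ { x y (s , s∈S , e) → afun α s , S-to α s s∈S , (begin
      afun α y ⊕ z                ≡⟨ cong (λ v → afun α v ⊕ z) e ⟩
      afun α (s ⊕ x) ⊕ z          ≡⟨ cong (_⊕ z) (hom α s x) ⟩
      (afun α s ⊕ afun α x) ⊕ z   ≡⟨ ⊕-assoc (afun α s) (afun α x) z ⟩
      afun α s ⊕ (afun α x ⊕ z)   ∎) }
  ; refl- = λ { x y (s , s∈S , e) → y ⊕ x , S-from α (y ⊕ x) (subst (InS n) (sym (difference x y s e)) s∈S) ,
                                     sym (⊕-cancelʳ y x) } }
  where
  open ≡-Reasoning
  difference : ∀ x y s → afun α y ⊕ z ≡ s ⊕ (afun α x ⊕ z) → afun α (y ⊕ x) ≡ s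
  difference x y s e = begin
    afun α (y ⊕ x)              ≡⟨ hom α y x ⟩
    afun α y ⊕ afun α x         ≡⟨ cong (_⊕ afun α x) (⊕-injʳ (afun α y) (s ⊕ afun α x) z
                                      (trans e (sym (⊕-assoc s (afun α x) z)))) ⟩
    (s ⊕ afun α x) ⊕ afun α x   ≡⟨ ⊕-cancelʳ s (afun α x) ⟩
    s                           ∎

module Stabiliser (m : ℕ) where

  open Linear m public

  lin-preserves-S : ∀ w s → InS N s → InS N (lin w s)
  lin-preserves-S w s s∈S with S⇒enc s s∈S
  ... | u , pu , refl = subst (InS N) (sym (lin-enc w u pu)) (enc∈S (ladderMap w u) (ladderMap-valid w u pu))

  lin-reflects-S : ∀ w s → InS N (lin w s) → InS N s
  lin-reflects-S w s ws∈S with S⇒enc (lin w s) ws∈S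
  ... | u , pu , e = subst (InS N) (sym s≡) (enc∈S (ladderMapInv w u) (ladderMapInv-valid w u pu))
    where s≡ : s ≡ enc (ladderMapInv w u)
          s≡ = trans (sym (linInv-lin w s)) (trans (cong (linInv w) e) (linInv-enc w u pu))

  linAut : List Gen → GrpAutS N
  linAut w = record
    { afun = lin w ; ainv = linInv w ; afun-inv = lin-linInv w ; ainv-fun = linInv-lin w
    ; hom = lin-additive w ; S-to = lin-preserves-S w ; S-from = lin-reflects-S w }

  symAut : D8 → GAut N
  symAut d = affine (linAut (word d)) zeroV

  symAut-apply : ∀ d x → fun (symAut d) x ≡ lin (word d) x
  symAut-apply d x = ⊕-identityʳ _

  symAut-zero : ∀ d → fun (symAut d) zeroV ≡ zeroV
  symAut-zero d = trans (symAut-apply d zeroV) (additive-zero (lin (word d)) (lin-additive (word d)))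

  -- An automorphism fixing 0 permutes S, the neighbourhood of 0, and so
  -- induces an automorphism of the ladder.
  zero-adj : ∀ u → Valid u → Adj N zeroV (enc u)
  zero-adj u pu = enc u , enc∈S u pu , sym (⊕-identityʳ (enc u))

  module Local (σ : GAut N) (σ0 : fun σ zeroV ≡ zeroV) where

    image-in-S : ∀ u → Valid u → Σ Ix λ w → Valid w × (fun σ (enc u) ≡ enc w)
    image-in-S u pu with subst (λ z → Adj N z (fun σ (enc u))) σ0 (pres σ zeroV (enc u) (zero-adj u pu))
    ... | s , s∈S , e with S⇒enc s s∈S
    ...   | w , pw , refl = w , pw , trans e (⊕-identityʳ (enc w))

    local : Ix → Ix
    local u = decode (fun σ (enc u))

    local-enc : ∀ u → Valid u → fun σ (enc u) ≡ enc (local u)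
    local-enc u pu with image-in-S u pu
    ... | w , pw , e = trans e (cong enc (sym (trans (cong decode e) (decode-enc w pw))))

    local-valid : ∀ u → Valid u → Valid (local u)
    local-valid u pu with image-in-S u pu
    ... | w , pw , e = subst Valid (sym (trans (cong decode e) (decode-enc w pw))) pw

  inverse-fixes-zero : ∀ (σ : GAut N) → fun σ zeroV ≡ zeroV → inv σ zeroV ≡ zeroV
  inverse-fixes-zero σ σ0 = trans (cong (inv σ) (sym σ0)) (inv-fun σ zeroV)

  localAut : Stab N → Automorphism
  localAut (σ , σ0) = record
    { to = L.local ; from = L⁻¹.local
    ; to-valid = L.local-valid ; from-valid = L⁻¹.local-valid
    ; from-to = λ u pu → trans (cong (λ v → decode (inv σ v)) (sym (L.local-enc u pu)))
                               (trans (cong decode (inv-fun σ (enc u))) (decode-enc u pu))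
    ; to-from = λ u pu → trans (cong (λ v → decode (fun σ v)) (sym (L⁻¹.local-enc u pu)))
                               (trans (cong decode (fun-inv σ (enc u))) (decode-enc u pu))
    ; to-link = λ u v pu pv l → Adj⇒Link _ _ (L.local-valid u pu) (L.local-valid v pv)
        (subst₂ (Adj N) (L.local-enc u pu) (L.local-enc v pv) (pres σ _ _ (Link⇒Adj u v pu pv l)))
    ; to-link⁻¹ = λ u v pu pv l → Adj⇒Link u v pu pv (refl- σ _ _
        (subst₂ (Adj N) (sym (L.local-enc u pu)) (sym (L.local-enc v pv))
          (Link⇒Adj _ _ (L.local-valid u pu) (L.local-valid v pv) l))) }
    where
    module L   = Local σ σ0
    module L⁻¹ = Local (inverseAut σ) (inverse-fixes-zero σ σ0)

  classOfAut : GAut N → D8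
  classOfAut σ = fromEnds (endLabel (decode (fun σ (enc (end (# 0))))))
                          (endLabel (decode (fun σ (enc (end (# 1))))))

  classOfAut-ext : ∀ (σ τ : GAut N) → σ ≈A τ → classOfAut σ ≡ classOfAut τ
  classOfAut-ext σ τ h = cong₂ fromEnds (cong (λ v → endLabel (decode v)) (h _))
                                        (cong (λ v → endLabel (decode v)) (h _))

  classOfAut-ends : ∀ (σ : GAut N) d → (∀ ℓ → fun σ (enc (end ℓ)) ≡ enc (end (act d ℓ))) → classOfAut σ ≡ d
  classOfAut-ends σ d h = trans (cong₂ fromEnds (label (# 0)) (label (# 1))) (fromEnds-act d)
    where
    label : ∀ ℓ → endLabel (decode (fun σ (enc (end ℓ)))) ≡ act d ℓ
    label ℓ = trans (cong (λ v → endLabel (decode v)) (h ℓ))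
                    (trans (cong endLabel (decode-enc (end (act d ℓ)) (end-valid _))) (endLabel-end _))

  stab-on-S : ∀ (st : Stab N) u → Valid u →
              fun (proj₁ st) (enc u) ≡ enc (ladderSym (classOfAut (proj₁ st)) u)
  stab-on-S (σ , σ0) u pu = trans (Local.local-enc σ σ0 u pu) (cong enc (Classify.classify (localAut (σ , σ0)) u pu))

  ladderSym-valid : ∀ d u → Valid u → Valid (ladderSym d u)
  ladderSym-valid d = ladderMap-valid (word d)

  F-injective : ∀ {a b} → F a ≡ F b → a ≡ b
  F-injective refl = refl

  U-injective : ∀ {a b} → U a ≡ U b → a ≡ b
  U-injective refl = refl

  innerF-stays-F : ∀ d y x → InnerF x → U y ≢ ladderSym d (F x)
  innerF-stays-F d y x ix e with () ← trans e (ladderSym-innerF d x ix)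

  innerU-stays-U : ∀ d y x → InnerU x → F y ≢ ladderSym d (U x)
  innerU-stays-U d y x ix e with () ← trans e (ladderSym-innerU d x ix)

  near-end₀ : ∀ v d' → Valid v → enc v ⊕ enc (F 1) ≡ enc (ladderSym d' v) → (v ≡ F 0) ⊎ (v ≡ U 0)
  near-end₀ (F k) d' pv e with sum⇒Link (F k) (F 1) _ pv (s≤s z≤n) (ladderSym-valid d' (F k) pv) e
  ... | inj₁ refl = inj₁ refl
  ... | inj₂ refl = ⊥-elim (innerF-stays-F d' 1 2 (s≤s z≤n , s≤s (s≤s z≤n))
        (enc-injective _ _ (s≤s z≤n) (ladderSym-valid d' (F 2) pv)
          (trans (sym (trans (⊕-comm (enc (F 2)) (enc (F 1))) (triangle 1))) e)))
  near-end₀ (U i) d' pv e with sum⇒Link (U i) (F 1) _ pv (s≤s z≤n) (ladderSym-valid d' (U i) pv) e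
  ... | inj₂ refl = inj₂ refl
  ... | inj₁ refl = ⊥-elim (innerU-stays-U d' 2 1 (s≤s z≤n , s≤s z≤n)
        (enc-injective _ _ (s≤s (s≤s z≤n)) (ladderSym-valid d' (U 1) pv)
          (trans (sym (trans (⊕-comm (enc (U 1)) (enc (F 1))) (triangle-FU 1))) e)))

  near-end₁ : ∀ v d' → Valid v → enc v ⊕ enc (F t) ≡ enc (ladderSym d' v) → (v ≡ F top) ⊎ (v ≡ U t)
  near-end₁ (F k) d' pv e with sum⇒Link (F k) (F t) _ pv (n≤1+n t) (ladderSym-valid d' (F k) pv) e
  ... | inj₂ refl = inj₁ refl
  ... | inj₁ refl = ⊥-elim (innerF-stays-F d' (suc m) (suc m) (s≤s z≤n , n≤1+n (suc m))
        (enc-injective _ _ (n≤1+n (suc m)) (ladderSym-valid d' (F (suc m)) pv) (trans (sym (triangle (suc m))) e)))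
  near-end₁ (U i) d' pv e with sum⇒Link (U i) (F t) _ pv (n≤1+n t) (ladderSym-valid d' (U i) pv) e
  ... | inj₁ refl = inj₂ refl
  ... | inj₂ refl = ⊥-elim (innerU-stays-U d' (suc m) (suc m) (s≤s z≤n , ≤-refl)
        (enc-injective _ _ (≤-trans (n≤1+n _) (n≤1+n _)) (ladderSym-valid d' (U (suc m)) pv)
          (trans (sym (triangle-UF (suc m))) e)))

  module LocalRigidity (s : Ix) (ps : Valid s) (d : D8)
      (fixes : ∀ u → Valid u → (u ≡ s) ⊎ Link s u → ladderSym d u ≡ u)
      (sums  : ∀ u → Valid u → Σ D8 λ d' → enc (ladderSym d u) ⊕ (enc s ⊕ enc u) ≡ enc (ladderSym d' s))
      where

    reflectedF : reverses d ≡ true → ∀ x → InnerF x → ladderSym d (F x) ≡ F x → top ∸ x ≡ x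
    reflectedF r x ix fx = F-injective (trans (sym (subst (λ b → ladderSym d (F x) ≡ F (reflectF b x)) r
                                                        (ladderSym-innerF d x ix))) fx)

    reflectedU : reverses d ≡ true → ∀ x → InnerU x → ladderSym d (U x) ≡ U x → t ∸ x ≡ x
    reflectedU r x ix fx = U-injective (trans (sym (subst (λ b → ladderSym d (U x) ≡ U (reflectU b x)) r
                                                        (ladderSym-innerU d x ix))) fx)

    -- a reversing d would fix s and a neighbour of s of the same type,
    -- i.e. two consecutive midpoints of the reversal
    not-reversing : reverses d ≡ true → ⊥
    not-reversing r with kind s ps
    ... | isEnd ℓ s≡ = reverses-no-fixed-end d ℓ r (end-injective _ _
            (trans (sym (ladderSym-end d ℓ)) (fixes (end ℓ) (end-valid ℓ) (inj₁ (sym s≡)))))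
    ... | isInnerF (suc zero) s≡ ix with () ← reflectedF r 1 ix (fixes (F 1) (innerF-valid ix) (inj₁ (sym s≡)))
    ... | isInnerF (suc (suc x)) s≡ ix@(_ , px) =
            <⇒≢ (m<n⇒m<1+n (n<1+n x)) (trans (sym (suc-injective (trans (sym (+-∸-assoc 1 x≤)) e₂))) e₁)
      where
      x≤ : x ≤ suc m
      x≤ = ≤-pred (≤-pred (m≤n⇒m≤1+n px))
      ix' : InnerF (suc x)
      ix' = s≤s z≤n , ≤-trans (n≤1+n _) px
      e₁ : top ∸ suc (suc x) ≡ suc (suc x)
      e₁ = reflectedF r _ ix (fixes (F (suc (suc x))) (innerF-valid ix) (inj₁ (sym s≡)))
      e₂ : top ∸ suc x ≡ suc x
      e₂ = reflectedF r _ ix' (fixes (F (suc x)) (innerF-valid ix')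
             (inj₂ (subst (λ v → Link v (F (suc x))) (sym s≡) (inj₂ refl))))
    ... | isInnerU x s≡ ix@(1≤x , x≤) = 1+n≢n (trans (sym (trans (+-∸-assoc 1 (m≤n⇒m≤1+n x≤)) (cong suc e₁))) e₂)
      where
      ix' : InnerF x
      ix' = 1≤x , m≤n⇒m≤1+n x≤
      e₁ : t ∸ x ≡ x
      e₁ = reflectedU r x ix (fixes (U x) (innerU-valid ix) (inj₁ (sym s≡)))
      e₂ : top ∸ x ≡ x
      e₂ = reflectedF r x ix' (fixes (F x) (innerF-valid ix')
             (inj₂ (subst (λ v → Link v (F x)) (sym s≡) (inj₁ refl))))

    -- d cannot exchange the ends F 0 and U 0: s would be adjacent to F 1
    not-swapping₀ : act d (# 0) ≡ # 2 → ⊥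
    not-swapping₀ e₀ = exclude (near-end₀ s d' ps s+F₁)
      where
      d' = proj₁ (sums (F 0) z≤n)
      dF₀ : ladderSym d (F 0) ≡ U 0
      dF₀ = trans (ladderSym-end d (# 0)) (cong end e₀)
      dU₀ : ladderSym d (U 0) ≡ F 0
      dU₀ = trans (ladderSym-end d (# 2)) (cong end (trans (act-partner d (# 0)) (cong partner e₀)))
      U₀+F₀ : enc (U 0) ⊕ enc (F 0) ≡ enc (F 1)
      U₀+F₀ = trans (⊕-comm (enc (U 0)) (enc (F 0))) (triangle-FU 0)
      s+F₁ : enc s ⊕ enc (F 1) ≡ enc (ladderSym d' s)
      s+F₁ = begin
        enc s ⊕ enc (F 1)                               ≡⟨ cong (enc s ⊕_) U₀+F₀ ⟨
        enc s ⊕ (enc (U 0) ⊕ enc (F 0))                 ≡⟨ ⊕-swap (enc s) (enc (U 0)) (enc (F 0)) ⟩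
        enc (U 0) ⊕ (enc s ⊕ enc (F 0))                 ≡⟨ cong (λ v → enc v ⊕ (enc s ⊕ enc (F 0))) dF₀ ⟨
        enc (ladderSym d (F 0)) ⊕ (enc s ⊕ enc (F 0))   ≡⟨ proj₂ (sums (F 0) z≤n) ⟩
        enc (ladderSym d' s)                            ∎ where open ≡-Reasoning
      exclude : (s ≡ F 0) ⊎ (s ≡ U 0) → ⊥
      exclude (inj₁ s≡) with () ← trans (sym dF₀) (fixes (F 0) z≤n (inj₁ (sym s≡)))
      exclude (inj₂ s≡) with () ← trans (sym dU₀) (fixes (U 0) z≤n (inj₁ (sym s≡)))

    not-swapping₁ : act d (# 1) ≡ # 3 → ⊥
    not-swapping₁ e₁ = exclude (near-end₁ s d' ps s+Fₜ)
      where
      d' = proj₁ (sums (F top) ≤-refl)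
      dFtop : ladderSym d (F top) ≡ U t
      dFtop = trans (ladderSym-end d (# 1)) (cong end e₁)
      dUt : ladderSym d (U t) ≡ F top
      dUt = trans (ladderSym-end d (# 3)) (cong end (trans (act-partner d (# 1)) (cong partner e₁)))
      s+Fₜ : enc s ⊕ enc (F t) ≡ enc (ladderSym d' s)
      s+Fₜ = begin
        enc s ⊕ enc (F t)                                   ≡⟨ cong (enc s ⊕_) (triangle-UF t) ⟨
        enc s ⊕ (enc (U t) ⊕ enc (F top))                   ≡⟨ ⊕-swap (enc s) (enc (U t)) (enc (F top)) ⟩
        enc (U t) ⊕ (enc s ⊕ enc (F top))                   ≡⟨ cong (λ v → enc v ⊕ (enc s ⊕ enc (F top))) dFtop ⟨
        enc (ladderSym d (F top)) ⊕ (enc s ⊕ enc (F top))   ≡⟨ proj₂ (sums (F top) ≤-refl) ⟩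
        enc (ladderSym d' s)                                ∎ where open ≡-Reasoning
      exclude : (s ≡ F top) ⊎ (s ≡ U t) → ⊥
      exclude (inj₁ s≡) with () ← trans (sym dFtop) (fixes (F top) ≤-refl (inj₁ (sym s≡)))
      exclude (inj₂ s≡) with () ← trans (sym dUt) (fixes (U t) ≤-refl (inj₁ (sym s≡)))

    is-identity : ∀ u → Valid u → ladderSym d u ≡ u
    is-identity u pu with reverses d in r
    ... | true  = ⊥-elim (not-reversing r)
    ... | false with act d (# 0) ≟ᶠ # 2 | act d (# 1) ≟ᶠ # 3
    ...   | yes e₀ | _      = ⊥-elim (not-swapping₀ e₀)
    ...   | no  _  | yes e₁ = ⊥-elim (not-swapping₁ e₁)
    ...   | no  n₀ | no  n₁ = cong (λ d' → ladderSym d' u) (identity-criterion d r n₀ n₁)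

  -- the automorphism x ↦ σ(x + y) + σ(y), i.e. σ seen from y; it fixes 0
  recentre : GAut N → V N → GAut N
  recentre σ y = compGAut (translation (fun σ y)) (compGAut σ (translation y))

  recentre-zero : ∀ σ y → fun (recentre σ y) zeroV ≡ zeroV
  recentre-zero σ y = trans (cong (λ v → fun σ v ⊕ fun σ y) (⊕-identityˡ y)) (⊕-self (fun σ y))

  -- Call x settled if σ fixes x and all its neighbours.  If x is settled and
  -- y = s + x is a neighbour, then σ seen from y is a symmetry d satisfying
  -- the hypotheses of local rigidity, so d = id and y is settled.  Every
  -- vector is reached from 0 by adding unit vectors, which lie in S.
  module Rigidity (σ : GAut N) (σ0 : fun σ zeroV ≡ zeroV)
                  (fixS : ∀ u → Valid u → fun σ (enc u) ≡ enc u) where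

    Settled : V N → Set
    Settled x = (fun σ x ≡ x) × (∀ u → Valid u → fun σ (enc u ⊕ x) ≡ enc u ⊕ x)

    settled-zero : Settled zeroV
    settled-zero = σ0 , λ u pu → trans (cong (fun σ) (⊕-identityʳ (enc u)))
                                       (trans (fixS u pu) (sym (⊕-identityʳ (enc u))))

    near : ∀ y → fun σ y ≡ y → ∀ u → Valid u →
           fun σ (enc u ⊕ y) ≡ enc (ladderSym (classOfAut (recentre σ y)) u) ⊕ y
    near y σy u pu = ⊕-move _ _ y
      (subst (λ z → fun σ (enc u ⊕ y) ⊕ z ≡ enc (ladderSym (classOfAut (recentre σ y)) u)) σy
                       (stab-on-S (recentre σ y , recentre-zero σ y) u pu))

    step : ∀ x → Settled x → ∀ s → Valid s → Settled (enc s ⊕ x)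
    step x (σx , σx-nbrs) s ps = σy , λ u pu → trans (near y σy u pu) (cong (λ v → enc v ⊕ y) (d-id u pu))
      where
      y = enc s ⊕ x
      σy : fun σ y ≡ y
      σy = σx-nbrs s ps
      d = classOfAut (recentre σ y)
      fixed : ∀ u → Valid u → fun σ (enc u ⊕ y) ≡ enc u ⊕ y → ladderSym d u ≡ u
      fixed u pu e = enc-injective _ _ (ladderSym-valid d u pu) pu
                       (⊕-injʳ _ _ y (trans (sym (near y σy u pu)) e))
      -- s + y = x, and u + y for u linked to s is a neighbour of x
      fixes : ∀ u → Valid u → (u ≡ s) ⊎ Link s u → ladderSym d u ≡ u
      fixes u pu (inj₁ refl) = fixed u pu (trans (cong (fun σ) (⊕-cancelˡ (enc u) x))
                                               (trans σx (sym (⊕-cancelˡ (enc u) x))))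
      fixes u pu (inj₂ l) with Link⇒sum u s pu ps (Link-sym s u l)
      ... | w , pw , e = fixed u pu (trans (cong (fun σ) u+y) (trans (σx-nbrs w pw) (sym u+y)))
        where u+y : enc u ⊕ y ≡ enc w ⊕ x
              u+y = trans (sym (⊕-assoc (enc u) (enc s) x)) (cong (_⊕ x) e)
      -- d(u) + s + u is the image of s under σ seen from u + x
      sums : ∀ u → Valid u → Σ D8 λ d' → enc (ladderSym d u) ⊕ (enc s ⊕ enc u) ≡ enc (ladderSym d' s)
      sums u pu = classOfAut (recentre σ x') , (begin
        du ⊕ (enc s ⊕ enc u)                         ≡⟨ ⊕-assoc du (enc s) (enc u) ⟨
        (du ⊕ enc s) ⊕ enc u                         ≡⟨ ⊕-cancel-common (du ⊕ enc s) (enc u) x ⟨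
        ((du ⊕ enc s) ⊕ x) ⊕ (enc u ⊕ x)             ≡⟨ cong (_⊕ (enc u ⊕ x)) (⊕-assoc du (enc s) x) ⟩
        (du ⊕ y) ⊕ (enc u ⊕ x)                       ≡⟨ cong₂ _⊕_ (near y σy u pu) (σx-nbrs u pu) ⟨
        fun σ (enc u ⊕ y) ⊕ fun σ x'                 ≡⟨ cong (λ v → fun σ v ⊕ fun σ x') (⊕-swap (enc u) (enc s) x) ⟩
        fun σ (enc s ⊕ x') ⊕ fun σ x'                ≡⟨ stab-on-S (recentre σ x' , recentre-zero σ x') s ps ⟩
        enc (ladderSym (classOfAut (recentre σ x')) s) ∎)
        where
        open ≡-Reasoning
        x' = enc u ⊕ x
        du = enc (ladderSym d u)
      d-id : ∀ u → Valid u → ladderSym d u ≡ u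
      d-id = LocalRigidity.is-identity s ps d fixes sums

    rigid : ∀ x → fun σ x ≡ x
    rigid x = proj₁ (V-induction Settled settled-zero add-unit x)
      where
      add-unit : ∀ k x → k < N → Settled x → Settled (unit N k ⊕ x)
      add-unit k x k<N sx with unit-in-S k k<N
      ... | u , pu , e = subst (λ v → Settled (v ⊕ x)) (sym e) (step x sx u pu)

  -- Every element of the stabiliser is the linear map of its class: undo
  -- the symmetry on S and apply rigidity.
  stab-linear : ∀ (st : Stab N) x → fun (proj₁ st) x ≡ lin (word (classOfAut (proj₁ st))) x
  stab-linear (σ , σ0) x = begin
    fun σ x                          ≡⟨ lin-linInv w (fun σ x) ⟨
    lin w (linInv w (fun σ x))       ≡⟨ cong (λ v → lin w (linInv w v)) (⊕-identityʳ (fun σ x)) ⟨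
    lin w (fun σ′ x)                 ≡⟨ cong (lin w) (Rigidity.rigid σ′ σ′-zero σ′-fixes-S x) ⟩
    lin w x                          ∎
    where
    open ≡-Reasoning
    d = classOfAut σ
    w = word d
    σ′ : GAut N
    σ′ = compGAut (inverseAut (symAut d)) σ
    σ′-zero : fun σ′ zeroV ≡ zeroV
    σ′-zero = begin
      linInv w (fun σ zeroV ⊕ zeroV)   ≡⟨ cong (λ v → linInv w (v ⊕ zeroV)) σ0 ⟩
      linInv w (zeroV ⊕ zeroV)         ≡⟨ cong (linInv w) (⊕-self zeroV) ⟩
      linInv w zeroV                   ≡⟨ additive-zero (linInv w) (linInv-additive w) ⟩
      zeroV                            ∎
    σ′-fixes-S : ∀ u → Valid u → fun σ′ (enc u) ≡ enc u
    σ′-fixes-S u pu = begin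
      linInv w (fun σ (enc u) ⊕ zeroV)   ≡⟨ cong (linInv w) (⊕-identityʳ _) ⟩
      linInv w (fun σ (enc u))           ≡⟨ cong (linInv w) (stab-on-S (σ , σ0) u pu) ⟩
      linInv w (enc (ladderSym d u))     ≡⟨ cong (linInv w) (lin-enc w u pu) ⟨
      linInv w (lin w (enc u))           ≡⟨ linInv-lin w (enc u) ⟩
      enc u                              ∎

module Main (m : ℕ) where

  open Stabiliser m

  linPart : GAut N → GAut N
  linPart σ = compGAut (translation (fun σ zeroV)) σ

  linPart-zero : ∀ σ → fun (linPart σ) zeroV ≡ zeroV
  linPart-zero σ = ⊕-self (fun σ zeroV)

  classOf : GAut N → D8
  classOf σ = classOfAut (linPart σ)

  affine-form : ∀ σ x → fun σ x ≡ lin (word (classOf σ)) x ⊕ fun σ zeroV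
  affine-form σ x = ⊕-move _ _ (fun σ zeroV) (stab-linear (linPart σ , linPart-zero σ) x)

  lin-end : ∀ d ℓ → lin (word d) (enc (end ℓ)) ≡ enc (end (act d ℓ))
  lin-end d ℓ = trans (lin-enc (word d) (end ℓ) (end-valid ℓ)) (cong enc (ladderSym-end d ℓ))

  lin-zero : ∀ d → lin (word d) zeroV ≡ zeroV
  lin-zero d = additive-zero (lin (word d)) (lin-additive (word d))

  classOf-ext : ∀ σ τ → σ ≈A τ → classOf σ ≡ classOf τ
  classOf-ext σ τ h = classOfAut-ext (linPart σ) (linPart τ) λ x → cong₂ _⊕_ (h x) (h zeroV)

  classOf-affine : ∀ d z → classOf (affine (linAut (word d)) z) ≡ d
  classOf-affine d z = classOfAut-ends (linPart (affine (linAut (word d)) z)) d λ ℓ → begin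
    (lin (word d) (enc (end ℓ)) ⊕ z) ⊕ (lin (word d) zeroV ⊕ z)
      ≡⟨ cong (λ v → (lin (word d) (enc (end ℓ)) ⊕ z) ⊕ (v ⊕ z)) (lin-zero d) ⟩
    (lin (word d) (enc (end ℓ)) ⊕ z) ⊕ (zeroV ⊕ z)
      ≡⟨ ⊕-cancel-common _ zeroV z ⟩
    lin (word d) (enc (end ℓ)) ⊕ zeroV
      ≡⟨ ⊕-identityʳ _ ⟩
    lin (word d) (enc (end ℓ))
      ≡⟨ lin-end d ℓ ⟩
    enc (end (act d ℓ)) ∎ where open ≡-Reasoning

  classOf-comp : ∀ σ τ → classOf (compGAut σ τ) ≡ classOf σ ·D8 classOf τ
  classOf-comp σ τ = classOfAut-ends (linPart (compGAut σ τ)) (a ·D8 b) λ ℓ → begin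
    fun σ (fun τ (e ℓ)) ⊕ fun σ (fun τ zeroV)
      ≡⟨ cong₂ _⊕_ (trans (affine-form σ _) (cong (λ v → A v ⊕ fun σ zeroV) (affine-form τ (e ℓ))))
                   (affine-form σ (fun τ zeroV)) ⟩
    (A (B (e ℓ) ⊕ fun τ zeroV) ⊕ fun σ zeroV) ⊕ (A (fun τ zeroV) ⊕ fun σ zeroV)
      ≡⟨ ⊕-cancel-common _ _ (fun σ zeroV) ⟩
    A (B (e ℓ) ⊕ fun τ zeroV) ⊕ A (fun τ zeroV)
      ≡⟨ cong (_⊕ A (fun τ zeroV)) (lin-additive (word a) (B (e ℓ)) (fun τ zeroV)) ⟩
    (A (B (e ℓ)) ⊕ A (fun τ zeroV)) ⊕ A (fun τ zeroV)
      ≡⟨ ⊕-cancelʳ _ _ ⟩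
    A (B (e ℓ))
      ≡⟨ trans (cong A (lin-end b ℓ)) (lin-end a (act b ℓ)) ⟩
    enc (end (act a (act b ℓ)))
      ≡⟨ cong (λ k → enc (end k)) (act-mul a b ℓ) ⟨
    enc (end (act (a ·D8 b) ℓ)) ∎
    where
    open ≡-Reasoning
    a = classOf σ
    b = classOf τ
    A = lin (word a)
    B = lin (word b)
    e : Fin 4 → V N
    e ℓ = enc (end ℓ)

  affine-determined : ∀ σ τ → classOf σ ≡ classOf τ → fun σ zeroV ≡ fun τ zeroV → σ ≈A τ
  affine-determined σ τ c z x = begin
    fun σ x                                  ≡⟨ affine-form σ x ⟩
    lin (word (classOf σ)) x ⊕ fun σ zeroV   ≡⟨ cong₂ (λ d v → lin (word d) x ⊕ v) c z ⟩
    lin (word (classOf τ)) x ⊕ fun τ zeroV   ≡⟨ affine-form τ x ⟨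
    fun τ x                                  ∎ where open ≡-Reasoning

  stabiliser≅D8 : Σ (Stab N → D8) λ φ → IsGroupIso _≈S_ compStab _·D8_ φ
  stabiliser≅D8 = (λ st → classOf (proj₁ st)) , record
    { resp = λ st st′ h → classOf-ext (proj₁ st) (proj₁ st′) h
    ; homo = λ { (σ , _) (τ , _) → classOf-comp σ τ }
    ; inj  = λ { (σ , σ0) (τ , τ0) c → affine-determined σ τ c (trans σ0 (sym τ0)) }
    ; surj = λ d → (symAut d , symAut-zero d) , classOf-affine d zeroV }

  normal : IsNormalCayley N
  normal = (λ σ → fun σ zeroV , linAut (word (classOf σ)) , affine-form σ)
         , (λ z α → affine α z , λ x → refl)

  ρ : D8 → V N → V N
  ρ d = lin (word d)

  -- ρ is an action: the composite of the symmetries d and d′ has class d · d′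
  ρ-mul : ∀ d d′ x → ρ (d ·D8 d′) x ≡ ρ d (ρ d′ x)
  ρ-mul d d′ x = begin
    lin (word (d ·D8 d′)) x                 ≡⟨ cong (λ c → lin (word c) x) class ⟨
    lin (word (classOf τ)) x                ≡⟨ ⊕-identityʳ _ ⟨
    lin (word (classOf τ)) x ⊕ zeroV        ≡⟨ cong (lin (word (classOf τ)) x ⊕_) τ-zero ⟨
    lin (word (classOf τ)) x ⊕ fun τ zeroV  ≡⟨ affine-form τ x ⟨
    fun τ x                                 ≡⟨ trans (symAut-apply d _) (cong (lin (word d)) (symAut-apply d′ x)) ⟩
    lin (word d) (lin (word d′) x)          ∎
    where
    open ≡-Reasoning
    τ = compGAut (symAut d) (symAut d′)
    τ-zero : fun τ zeroV ≡ zeroV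
    τ-zero = trans (cong (fun (symAut d)) (symAut-zero d′)) (symAut-zero d)
    class : classOf τ ≡ d ·D8 d′
    class = trans (classOf-comp (symAut d) (symAut d′))
                  (cong₂ _·D8_ (classOf-affine d zeroV) (classOf-affine d′ zeroV))

  ρ-action : IsAutAction N ρ
  ρ-action = record { act-unit = λ z → refl ; act-mul = ρ-mul ; act-hom = λ d → lin-additive (word d) }

  ψ : GAut N → V N × D8
  ψ σ = fun σ zeroV , classOf σ

  ψ-iso : IsGroupIso _≈A_ compGAut (semiMul ρ) ψ
  ψ-iso = record
    { resp = λ σ τ h → cong₂ _,_ (h zeroV) (classOf-ext σ τ h)
    ; homo = λ σ τ → cong₂ _,_ (trans (affine-form σ (fun τ zeroV)) (⊕-comm _ _)) (classOf-comp σ τ)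
    ; inj  = λ σ τ e → affine-determined σ τ (cong proj₂ e) (cong proj₁ e)
    ; surj = λ { (z , d) → affine (linAut (word d)) z ,
                           cong₂ _,_ (trans (cong (_⊕ z) (lin-zero d)) (⊕-identityˡ z)) (classOf-affine d z) } }

mainTheorem5 : (n : ℕ) → 4 ≤ n →
    (Σ (Stab n → D8) λ φ → IsGroupIso _≈S_ compStab _·D8_ φ)
    × IsNormalCayley n
    × (Σ (D8 → V n → V n) λ ρ → IsAutAction n ρ
         × (Σ (GAut n → V n × D8) λ ψ → IsGroupIso _≈A_ compGAut (semiMul ρ) ψ))
mainTheorem5 n (s≤s (s≤s (s≤s (s≤s {n = m} z≤n)))) =
  stabiliser≅D8 , normal , ρ , ρ-action , ψ , ψ-iso
  where open Main m
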